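{- For all integers $n \geq 1$, \[ \omega(n) = \log_2\left[ \sum_{k=1}^n \sum_{j=1}^k \left( \sum_{d \mid k} \sum_{i=1}^d p(d-ji)\,\mu(k/d) \right) s_{n,k}\, |\mu(j)| \right], \] where $s_{n,k} := [q^n]\,(q;q)_\infty \frac{q^k}{1-q^k}$.
   Context: $\omega(n)$ is the number of distinct primes dividing $n$; $\mu$ is the Möbius function; $p(m)$ is the partition function with $p(0)=1$ and $p(m)=0$ for $m<0$; $(q;q)_\infty := \prod_{m\ge1}(1-q^m)$. The number $s_{n,k}$ equals $s_o(n,k)-s_e(n,k)$, the difference between the number of parts equal to $k$ over all partitions of $n$ into an odd, respectively even, number of distinct parts. -}

module Defs where

open import Data.Nat as ℕ using (ℕ; zero; suc; _∸_; _≤?_; _≟_)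
open import Data.Nat.Divisibility using (_∣_; _∣?_)
open import Data.Nat.DivMod using (_/_)
open import Data.Nat.Primality using (Prime; prime?)
open import Data.Integer as ℤ using (ℤ; +_; -[1+_]; ∣_∣)
open import Data.List using (List; []; _∷_; map; filter; length; concatMap; upTo)
open import Data.Bool using (Bool; true; false; if_then_else_)
open import Relation.Nullary.Decidable using (does; _×-dec_; ¬?; _⊎-dec_)
open import Data.List.Relation.Unary.Any using (any?)

range : ℕ → ℕ → List ℕ
range a b = map (λ i → a ℕ.+ i) (upTo (suc b ∸ a))

Σℤ : List ℕ → (ℕ → ℤ) → ℤ
Σℤ []       f = + 0
Σℤ (x ∷ xs) f = f x ℤ.+ Σℤ xs f

-- ω(n): number of distinct primes dividing n (primes lie in [1..n] for n ≥ 1)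

ω : ℕ → ℕ
ω n = length (filter (λ p → prime? p ×-dec p ∣? n) (range 1 n))

Squarefree? : ℕ → Bool
Squarefree? n = does (¬? (any? (λ d → (d ℕ.* d) ∣? n) (range 2 n)))

μ : ℕ → ℤ
μ n = if Squarefree? n then (ℤ.- (+ 1)) ℤ.^ ω n else + 0

-- Partition function p(m): number of partitions of m, counted via
-- multiplicity vectors (c₁,…,c_m) with 0 ≤ cᵢ ≤ m and Σ i·cᵢ = m.

lists : ℕ → ℕ → List (List ℕ)
lists zero    b = [] ∷ []
lists (suc l) b = concatMap (λ c → map (c ∷_) (lists l b)) (upTo (suc b))

weight : ℕ → List ℕ → ℕ
weight s []       = 0
weight s (c ∷ cs) = s ℕ.* c ℕ.+ weight (suc s) cs

p : ℕ → ℕ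
p m = length (filter (λ c → weight 1 c ≟ m) (lists m m))

pℤ : ℤ → ℤ
pℤ (+ m)    = + p m
pℤ -[1+ _ ] = + 0

Series : Set
Series = ℕ → ℤ

_⊛_ : Series → Series → Series
(f ⊛ g) n = Σℤ (range 0 n) (λ i → f i ℤ.* g (n ∸ i))

one : Series
one zero    = + 1
one (suc _) = + 0

oneMinusQ^ : ℕ → Series
oneMinusQ^ m i =
  if does (i ≟ 0) then + 1 else (if does (i ≟ m) then ℤ.- (+ 1) else + 0)

qqUpTo : ℕ → Series
qqUpTo zero    = one
qqUpTo (suc N) = qqUpTo N ⊛ oneMinusQ^ (suc N)

-- (q;q)_∞ : its coefficient of q^j is that of the finite product up to m = j
-- (factors with m > j do not affect coefficients of degree ≤ j).
qq∞ : Series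
qq∞ j = qqUpTo j j

-- q^k/(1-q^k) = Σ_{t ≥ 1} q^{k t}  (k ≥ 1): coefficient 1 at i = k t, t ≥ 1
geomQ : ℕ → Series
geomQ k i = Σℤ (range 1 i) (λ t → if does (k ℕ.* t ≟ i) then + 1 else + 0)

s : ℕ → ℕ → ℤ
s n k = (qq∞ ⊛ geomQ k) n

-- inner coefficient  Σ_{d ∣ k} Σ_{i=1}^{d} p(d - j i) μ(k/d)
-- (d ranges over 1..k, written d = suc e so that k / d is defined)

inner : ℕ → ℕ → ℤ
inner k j = Σℤ (range 0 (k ∸ 1)) λ e →
  if does (suc e ∣? k)
  then Σℤ (range 1 (suc e)) (λ i →
         pℤ (+ (suc e) ℤ.- (+ j ℤ.* + i)) ℤ.* μ (k / suc e))
  else + 0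

S : ℕ → ℤ
S n = Σℤ (range 1 n) λ k → Σℤ (range 1 k) λ j →
        inner k j ℤ.* s n k ℤ.* (+ ∣ μ j ∣)

module Submission where

-- The identity  S n = 2^ω(n)  is a chain of four exchanges of finite sums.
--
--  1. Writing a(k) = Σ_{j ≤ k} inner(k,j)·|μ(j)| and expanding
--     s_{n,k} = Σ_i [q^i](q;q)_∞ · [q^{n-i}] q^k/(1-q^k), where the second
--     factor is the indicator [k ∣ n-i] for n-i ≥ 1, the sum S n becomes
--     Σ_i [q^i](q;q)_∞ · Σ_{k ∣ n-i} a(k).
--  2. By definition a(k) = Σ_{d ∣ k} μ(k/d) b(d) with
--     b(m) = Σ_j |μ(j)| Σ_t p(m - j t); Möbius inversion (Σ_{d ∣ m} μ(d) = [m = 1])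
--     gives Σ_{k ∣ m} a(k) = b(m).
--  3. Euler's identity (q;q)_∞ · Σ p(m) q^m = 1 collapses
--     Σ_i [q^i](q;q)_∞ b(n-i) to Σ_{j ∣ n} |μ(j)|.
--  4. Σ_{j ∣ n} |μ(j)| = 2^ω(n), the number of squarefree divisors of n.
--
-- Euler's identity is proved by showing
-- that (1 - q^m) and Σ_t q^{m t} are inverse and that the coefficients of
-- ∏_{m ≤ N} Σ_t q^{m t} count the multiplicity vectors defining p. The two
-- divisor sums of μ and |μ| are proved together by induction along a prime
-- factorisation.

open import Defs
open import Data.Nat as ℕ using (ℕ; zero; suc; _<_; _≤_; _≥_; _^_; _∸_; _≟_; s≤s; z≤n; >-nonZero; nonTrivial⇒n>1; nonTrivial⇒≢1)
import Data.Nat.Properties as NP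
open import Data.Integer as ℤ using (ℤ; +_; -_; _*_; _+_; _-_; ∣_∣)
import Data.Integer.Properties as ZP
open import Data.Integer.Tactic.RingSolver using (solve-∀)
open import Data.Nat.Divisibility using (_∣_; _∣?_; divides; *-cancelˡ-∣; *-monoʳ-∣; *-pres-∣; m∣m*n; n∣n; ∣-trans; ∣m+n∣m⇒∣n; ∣m∸n∣n⇒∣m; ∣n⇒∣m*n; ∣⇒≤)
open import Data.Nat.DivMod using (_/_; m*n/n≡m)
open import Data.Nat.Primality using (Prime; euclidsLemma; prime?; prime⇒irreducible; prime⇒nonTrivial)
open import Data.Nat.Primality.Factorisation using (PrimeFactorisation; factorise)
open import Data.Nat.Coprimality using (Coprime; coprime-divisor)
open import Data.Nat.ListAction using (product)
open import Data.List using (List; []; _∷_; _++_; map; concatMap; filter; length; upTo; applyUpTo)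
open import Data.List.Membership.Propositional using (_∈_; find; lose)
open import Data.List.Membership.Propositional.Properties using (∈-map⁺; ∈-map⁻; ∈-upTo⁺; ∈-upTo⁻)
open import Data.List.Relation.Unary.Any using (Any; any?)
open import Data.List.Relation.Unary.All using (All; []; _∷_)
open import Data.Bool using (Bool; true; false; if_then_else_; not)
open import Data.Product using (_,_; _×_; proj₁; proj₂)
open import Data.Sum using (inj₁; inj₂)
open import Data.Empty using (⊥-elim)
open import Function using (_∘_)
open import Relation.Nullary using (¬_)
open import Relation.Nullary.Decidable using (Dec; yes; no; does; dec-true; dec-false; _×-dec_; ¬?)
open import Relation.Unary using (Decidable)
open import Relation.Binary.PropositionalEquality

open ≡-Reasoning

𝟙 : Bool → ℤ
𝟙 b = if b then + 1 else + 0

𝟙-yes : ∀ {P : Set} (P? : Dec P) → P → 𝟙 (does P?) ≡ + 1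
𝟙-yes P? x rewrite dec-true P? x = refl

𝟙-no : ∀ {P : Set} (P? : Dec P) → ¬ P → 𝟙 (does P?) ≡ + 0
𝟙-no P? x rewrite dec-false P? x = refl

𝟙-idem : ∀ b x → 𝟙 b * (𝟙 b * x) ≡ 𝟙 b * x
𝟙-idem true  x = ZP.*-identityˡ _
𝟙-idem false x = trans (ZP.*-zeroˡ (+ 0 * x)) (sym (ZP.*-zeroˡ x))

if-as-𝟙 : ∀ b X → (if b then X else + 0) ≡ 𝟙 b * X
if-as-𝟙 true  X = sym (ZP.*-identityˡ X)
if-as-𝟙 false X = sym (ZP.*-zeroˡ X)

does-iff : ∀ {A B : Set} (A? : Dec A) (B? : Dec B) → (A → B) → (B → A) → does A? ≡ does B?
does-iff (yes a) (yes b) f g = refl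
does-iff (yes a) (no ¬b) f g = ⊥-elim (¬b (f a))
does-iff (no ¬a) (yes b) f g = ⊥-elim (¬a (g b))
does-iff (no ¬a) (no ¬b) f g = refl

δ : ℕ → ℕ → ℤ
δ x y = 𝟙 (does (x ≟ y))

δ-refl : ∀ x → δ x x ≡ + 1
δ-refl x = 𝟙-yes (x ≟ x) refl

δ-no : ∀ x y → x ≢ y → δ x y ≡ + 0
δ-no x y = 𝟙-no (x ≟ y)

δ*-hit : ∀ x y (v : ℤ) → x ≡ y → δ x y * v ≡ v
δ*-hit x .x v refl = trans (cong (_* v) (δ-refl x)) (ZP.*-identityˡ v)

δ*-miss : ∀ x y (v : ℤ) → x ≢ y → δ x y * v ≡ + 0
δ*-miss x y v ne = trans (cong (_* v) (δ-no x y ne)) (ZP.*-zeroˡ v)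

ΣL : {A : Set} → List A → (A → ℤ) → ℤ
ΣL []       f = + 0
ΣL (x ∷ xs) f = f x + ΣL xs f

module _ {A : Set} where

  ΣL-cong : (xs : List A) {f g : A → ℤ} → (∀ x → f x ≡ g x) → ΣL xs f ≡ ΣL xs g
  ΣL-cong []       h = refl
  ΣL-cong (x ∷ xs) h = cong₂ _+_ (h x) (ΣL-cong xs h)

  ΣL-0 : (xs : List A) → ΣL xs (λ _ → + 0) ≡ + 0
  ΣL-0 []       = refl
  ΣL-0 (x ∷ xs) = trans (ZP.+-identityˡ _) (ΣL-0 xs)

  ΣL-+ : (xs : List A) (f g : A → ℤ) → ΣL xs (λ x → f x + g x) ≡ ΣL xs f + ΣL xs g
  ΣL-+ []       f g = refl
  ΣL-+ (x ∷ xs) f g = begin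
    f x + g x + ΣL xs (λ x → f x + g x)   ≡⟨ cong (_+_ (f x + g x)) (ΣL-+ xs f g) ⟩
    f x + g x + (ΣL xs f + ΣL xs g)       ≡⟨ interchange (f x) (g x) (ΣL xs f) (ΣL xs g) ⟩
    f x + ΣL xs f + (g x + ΣL xs g)       ∎
    where
    interchange : ∀ a b c d → a + b + (c + d) ≡ a + c + (b + d)
    interchange = solve-∀

  ΣL-*ˡ : (xs : List A) (c : ℤ) (f : A → ℤ) → c * ΣL xs f ≡ ΣL xs (λ x → c * f x)
  ΣL-*ˡ []       c f = ZP.*-zeroʳ c
  ΣL-*ˡ (x ∷ xs) c f = trans (ZP.*-distribˡ-+ c (f x) (ΣL xs f)) (cong (_+_ (c * f x)) (ΣL-*ˡ xs c f))

  ΣL-*ʳ : (xs : List A) (c : ℤ) (f : A → ℤ) → ΣL xs f * c ≡ ΣL xs (λ x → f x * c)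
  ΣL-*ʳ xs c f = trans (ZP.*-comm (ΣL xs f) c) (trans (ΣL-*ˡ xs c f) (ΣL-cong xs (λ x → ZP.*-comm c (f x))))

  ΣL-neg : (xs : List A) (f : A → ℤ) → - ΣL xs f ≡ ΣL xs (λ x → - f x)
  ΣL-neg []       f = refl
  ΣL-neg (x ∷ xs) f = trans (ZP.neg-distrib-+ (f x) (ΣL xs f)) (cong (_+_ (- f x)) (ΣL-neg xs f))

  ΣL-++ : (xs ys : List A) (f : A → ℤ) → ΣL (xs ++ ys) f ≡ ΣL xs f + ΣL ys f
  ΣL-++ []       ys f = sym (ZP.+-identityˡ _)
  ΣL-++ (x ∷ xs) ys f = trans (cong (_+_ (f x)) (ΣL-++ xs ys f)) (sym (ZP.+-assoc (f x) _ _))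

  length-filter : {P : A → Set} (P? : Decidable P) (xs : List A) →
                  + length (filter P? xs) ≡ ΣL xs (λ x → 𝟙 (does (P? x)))
  length-filter P? []       = refl
  length-filter P? (x ∷ xs) with does (P? x)
  ... | true  = trans (ZP.pos-+ 1 (length (filter P? xs))) (cong (_+_ (+ 1)) (length-filter P? xs))
  ... | false = trans (length-filter P? xs) (sym (ZP.+-identityˡ _))

ΣL-swap : {A B : Set} (xs : List A) (ys : List B) (F : A → B → ℤ) →
          ΣL xs (λ x → ΣL ys (F x)) ≡ ΣL ys (λ y → ΣL xs (λ x → F x y))
ΣL-swap []       ys F = sym (ΣL-0 ys)
ΣL-swap (x ∷ xs) ys F =
  trans (cong (_+_ (ΣL ys (F x))) (ΣL-swap xs ys F)) (sym (ΣL-+ ys (F x) (λ y → ΣL xs (λ x → F x y))))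

ΣL-map : {A B : Set} (g : A → B) (xs : List A) (f : B → ℤ) → ΣL (map g xs) f ≡ ΣL xs (f ∘ g)
ΣL-map g []       f = refl
ΣL-map g (x ∷ xs) f = cong (_+_ (f (g x))) (ΣL-map g xs f)

ΣL-concatMap : {A B : Set} (F : A → List B) (xs : List A) (f : B → ℤ) →
               ΣL (concatMap F xs) f ≡ ΣL xs (λ x → ΣL (F x) f)
ΣL-concatMap F []       f = refl
ΣL-concatMap F (x ∷ xs) f =
  trans (ΣL-++ (F x) (concatMap F xs) f) (cong (_+_ (ΣL (F x) f)) (ΣL-concatMap F xs f))

ΣL-Σℤ : (xs : List ℕ) (f : ℕ → ℤ) → ΣL xs f ≡ Σℤ xs f
ΣL-Σℤ []       f = refl
ΣL-Σℤ (x ∷ xs) f = cong (_+_ (f x)) (ΣL-Σℤ xs f)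

σ : ℕ → (ℕ → ℤ) → ℤ
σ zero    f = + 0
σ (suc n) f = f 0 + σ n (f ∘ suc)

ΣL-applyUpTo : ∀ n (g : ℕ → ℕ) (f : ℕ → ℤ) → ΣL (applyUpTo g n) f ≡ σ n (f ∘ g)
ΣL-applyUpTo zero    g f = refl
ΣL-applyUpTo (suc n) g f = cong (_+_ (f (g 0))) (ΣL-applyUpTo n (g ∘ suc) f)

ΣL-range : ∀ a b (f : ℕ → ℤ) → ΣL (range a b) f ≡ σ (suc b ∸ a) (λ i → f (a ℕ.+ i))
ΣL-range a b f = trans (ΣL-map (a ℕ.+_) (upTo (suc b ∸ a)) f) (ΣL-applyUpTo (suc b ∸ a) (λ i → i) _)

σ-cong : ∀ n {f g : ℕ → ℤ} → (∀ i → i < n → f i ≡ g i) → σ n f ≡ σ n g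
σ-cong zero    h = refl
σ-cong (suc n) h = cong₂ _+_ (h 0 (s≤s z≤n)) (σ-cong n (λ i i<n → h (suc i) (s≤s i<n)))

σ-zero : ∀ n {f : ℕ → ℤ} → (∀ i → i < n → f i ≡ + 0) → σ n f ≡ + 0
σ-zero zero    h = refl
σ-zero (suc n) h = trans (cong₂ _+_ (h 0 (s≤s z≤n)) (σ-zero n (λ i i<n → h (suc i) (s≤s i<n)))) (ZP.+-identityˡ _)

σ-split : ∀ m k (f : ℕ → ℤ) → σ (m ℕ.+ k) f ≡ σ m f + σ k (λ i → f (m ℕ.+ i))
σ-split zero    k f = sym (ZP.+-identityˡ _)
σ-split (suc m) k f = trans (cong (_+_ (f 0)) (σ-split m k (f ∘ suc))) (sym (ZP.+-assoc (f 0) _ _))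

σ-ext : ∀ m m' (f : ℕ → ℤ) → m ≤ m' → (∀ i → m ≤ i → i < m' → f i ≡ + 0) → σ m f ≡ σ m' f
σ-ext m m' f m≤m' h = begin
  σ m f                                   ≡⟨ sym (ZP.+-identityʳ _) ⟩
  σ m f + + 0                             ≡⟨ cong (_+_ (σ m f)) (sym (σ-zero (m' ∸ m) tail-vanishes)) ⟩
  σ m f + σ (m' ∸ m) (λ i → f (m ℕ.+ i))  ≡⟨ sym (σ-split m (m' ∸ m) f) ⟩
  σ (m ℕ.+ (m' ∸ m)) f                    ≡⟨ cong (λ z → σ z f) (NP.m+[n∸m]≡n m≤m') ⟩
  σ m' f                                  ∎
  where
  tail-vanishes : ∀ i → i < m' ∸ m → f (m ℕ.+ i) ≡ + 0
  tail-vanishes i i< = h (m ℕ.+ i) (NP.m≤m+n m i)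
    (subst (m ℕ.+ i <_) (NP.m+[n∸m]≡n m≤m') (NP.+-monoʳ-< m i<))

σ-single : ∀ n q (f : ℕ → ℤ) → q < n → (∀ i → i < n → i ≢ q → f i ≡ + 0) → σ n f ≡ f q
σ-single (suc n) zero    f q<n h =
  trans (cong (_+_ (f 0)) (σ-zero n (λ i i< → h (suc i) (s≤s i<) (λ ())))) (ZP.+-identityʳ _)
σ-single (suc n) (suc q) f (s≤s q<n) h =
  trans (cong (λ z → z + σ n (f ∘ suc)) (h 0 (s≤s z≤n) (λ ())))
    (trans (ZP.+-identityˡ _)
      (σ-single n q (f ∘ suc) q<n (λ i i< i≢ → h (suc i) (s≤s i<) (i≢ ∘ NP.suc-injective))))

range-bound : ∀ a b i → i < suc b ∸ a → a ℕ.+ i ≤ b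
range-bound a b i i< with a NP.≤? suc b
... | yes a≤ = NP.≤-pred (subst (suc (a ℕ.+ i) ≤_) (NP.m+[n∸m]≡n a≤)
                 (subst (_≤ a ℕ.+ (suc b ∸ a)) (NP.+-suc a i) (NP.+-monoʳ-≤ a i<)))
... | no a≰ = ⊥-elim (NP.n≮0 (subst (i <_) (NP.m≤n⇒m∸n≡0 (NP.<⇒≤ (NP.≰⇒> a≰))) i<))

-- ΣR a b f = Σ_{a ≤ x ≤ b} f x. It is kept opaque so that the normaliser
-- never unfolds sums; all reasoning goes through the lemmas below.
opaque
  ΣR : ℕ → ℕ → (ℕ → ℤ) → ℤ
  ΣR a b f = ΣL (range a b) f

  ΣR-as-ΣL : ∀ a b (f : ℕ → ℤ) → ΣR a b f ≡ ΣL (range a b) f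
  ΣR-as-ΣL a b f = refl

  ΣR-def : ∀ a b (f : ℕ → ℤ) → ΣR a b f ≡ Σℤ (range a b) f
  ΣR-def a b f = ΣL-Σℤ (range a b) f

  ΣR-cong : ∀ a b {f g : ℕ → ℤ} → (∀ x → a ≤ x → x ≤ b → f x ≡ g x) → ΣR a b f ≡ ΣR a b g
  ΣR-cong a b {f} {g} h = trans (ΣL-range a b f)
    (trans (σ-cong (suc b ∸ a) (λ i i< → h (a ℕ.+ i) (NP.m≤m+n a i) (range-bound a b i i<)))
      (sym (ΣL-range a b g)))

  ΣR-zero : ∀ a b {f : ℕ → ℤ} → (∀ x → a ≤ x → x ≤ b → f x ≡ + 0) → ΣR a b f ≡ + 0
  ΣR-zero a b h = trans (ΣR-cong a b h) (ΣL-0 (range a b))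

  ΣR-ext : ∀ a b b' (f : ℕ → ℤ) → b ≤ b' → (∀ x → b < x → x ≤ b' → f x ≡ + 0) → ΣR a b f ≡ ΣR a b' f
  ΣR-ext a b b' f b≤b' h = trans (ΣL-range a b f)
    (trans (σ-ext (suc b ∸ a) (suc b' ∸ a) _ (NP.∸-monoˡ-≤ a (s≤s b≤b'))
      (λ i m≤i i<m' → h (a ℕ.+ i) (NP.≤-trans (NP.m≤n+m∸n (suc b) a) (NP.+-monoʳ-≤ a m≤i))
                                  (range-bound a b' i i<m')))
      (sym (ΣL-range a b' f)))

  ΣR-single : ∀ a b q (f : ℕ → ℤ) → a ≤ q → q ≤ b →
              (∀ x → a ≤ x → x ≤ b → x ≢ q → f x ≡ + 0) → ΣR a b f ≡ f q
  ΣR-single a b q f a≤q q≤b h = trans (ΣL-range a b f)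
    (trans (σ-single (suc b ∸ a) (q ∸ a) _ (NP.∸-monoˡ-< (s≤s q≤b) a≤q)
      (λ i i< i≢ → h (a ℕ.+ i) (NP.m≤m+n a i) (range-bound a b i i<)
                     (λ e → i≢ (trans (sym (NP.m+n∸m≡n a i)) (cong (_∸ a) e)))))
      (cong f (NP.m+[n∸m]≡n a≤q)))

  ΣR-empty : ∀ a b (f : ℕ → ℤ) → b < a → ΣR a b f ≡ + 0
  ΣR-empty a b f b<a =
    trans (ΣL-range a b f) (cong (λ z → σ z (λ i → f (a ℕ.+ i))) (NP.m≤n⇒m∸n≡0 b<a))

  ΣR-shift : ∀ k (F : ℕ → ℤ) → ΣR 0 k (F ∘ suc) ≡ ΣR 1 (suc k) F
  ΣR-shift k F = trans (ΣL-range 0 k (F ∘ suc)) (sym (ΣL-range 1 (suc k) F))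

  ΣR-+ : ∀ a b (f g : ℕ → ℤ) → ΣR a b (λ x → f x + g x) ≡ ΣR a b f + ΣR a b g
  ΣR-+ a b = ΣL-+ (range a b)

  ΣR-*ˡ : ∀ a b (c : ℤ) (f : ℕ → ℤ) → c * ΣR a b f ≡ ΣR a b (λ x → c * f x)
  ΣR-*ˡ a b = ΣL-*ˡ (range a b)

  ΣR-*ʳ : ∀ a b (c : ℤ) (f : ℕ → ℤ) → ΣR a b f * c ≡ ΣR a b (λ x → f x * c)
  ΣR-*ʳ a b = ΣL-*ʳ (range a b)

  ΣR-neg : ∀ a b (f : ℕ → ℤ) → - ΣR a b f ≡ ΣR a b (λ x → - f x)
  ΣR-neg a b = ΣL-neg (range a b)

  ΣR-swap : ∀ a b c d (F : ℕ → ℕ → ℤ) →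
            ΣR a b (λ x → ΣR c d (F x)) ≡ ΣR c d (λ y → ΣR a b (λ x → F x y))
  ΣR-swap a b c d = ΣL-swap (range a b) (range c d)

  ΣL-upTo : ∀ b (F : ℕ → ℤ) → ΣL (upTo (suc b)) F ≡ ΣR 0 b F
  ΣL-upTo b F = sym (ΣL-map (0 ℕ.+_) (upTo (suc b)) F)

ΣR-δ-in : ∀ n q (F : ℕ → ℤ) → q ≤ n → ΣR 0 n (λ i → δ i q * F i) ≡ F q
ΣR-δ-in n q F q≤n =
  trans (ΣR-single 0 n q _ z≤n q≤n (λ i _ _ i≢ → δ*-miss i q (F i) i≢)) (δ*-hit q q (F q) refl)

ΣR-δ-out : ∀ n q (F : ℕ → ℤ) → n < q → ΣR 0 n (λ i → δ i q * F i) ≡ + 0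
ΣR-δ-out n q F n<q = ΣR-zero 0 n (λ i _ i≤n → δ*-miss i q (F i) (λ e → NP.<⇒≱ n<q (subst (_≤ n) e i≤n)))

-- Formal power series: the Cauchy product is a commutative monoid

_≈_ : Series → Series → Set
f ≈ g = ∀ n → f n ≡ g n

≈-trans : ∀ {f g h} → f ≈ g → g ≈ h → f ≈ h
≈-trans a b n = trans (a n) (b n)

≈-sym : ∀ {f g} → f ≈ g → g ≈ f
≈-sym a n = sym (a n)

⊛-as-ΣR : ∀ f g n → (f ⊛ g) n ≡ ΣR 0 n (λ i → f i * g (n ∸ i))
⊛-as-ΣR f g n = sym (ΣR-def 0 n (λ i → f i * g (n ∸ i)))

⊛-as-δ-sum : ∀ f g n N → n ≤ N →
             (f ⊛ g) n ≡ ΣR 0 N (λ i → ΣR 0 N (λ j → δ (i ℕ.+ j) n * (f i * g j)))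
⊛-as-δ-sum f g n N n≤N = begin
  (f ⊛ g) n                                                   ≡⟨ ⊛-as-ΣR f g n ⟩
  ΣR 0 n (λ i → f i * g (n ∸ i))                              ≡⟨ ΣR-cong 0 n (λ i _ i≤n → sym (row i i≤n)) ⟩
  ΣR 0 n (λ i → ΣR 0 N (λ j → δ (i ℕ.+ j) n * (f i * g j)))
    ≡⟨ ΣR-ext 0 n N _ n≤N (λ i n<i _ → ΣR-zero 0 N (λ j _ _ →
         δ*-miss _ _ _ (λ e → NP.<⇒≱ n<i (subst (i ≤_) e (NP.m≤m+n i j))))) ⟩
  ΣR 0 N (λ i → ΣR 0 N (λ j → δ (i ℕ.+ j) n * (f i * g j)))  ∎
  where
  row : ∀ i → i ≤ n → ΣR 0 N (λ j → δ (i ℕ.+ j) n * (f i * g j)) ≡ f i * g (n ∸ i)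
  row i i≤n = trans (ΣR-single 0 N (n ∸ i) _ z≤n (NP.≤-trans (NP.m∸n≤m n i) n≤N)
      (λ j _ _ j≢ → δ*-miss _ _ _ (λ e → j≢ (trans (sym (NP.m+n∸m≡n i j)) (cong (_∸ i) e)))))
    (δ*-hit _ _ _ (NP.m+[n∸m]≡n i≤n))

⊛-cong-upto : ∀ f f' g g' n → (∀ i → i ≤ n → f i ≡ f' i) → (∀ i → i ≤ n → g i ≡ g' i) →
              (f ⊛ g) n ≡ (f' ⊛ g') n
⊛-cong-upto f f' g g' n hf hg = trans (⊛-as-ΣR f g n)
  (trans (ΣR-cong 0 n (λ i _ i≤n → cong₂ _*_ (hf i i≤n) (hg (n ∸ i) (NP.m∸n≤m n i))))
    (sym (⊛-as-ΣR f' g' n)))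

⊛-congˡ : ∀ {f f'} g → f ≈ f' → (f ⊛ g) ≈ (f' ⊛ g)
⊛-congˡ {f} {f'} g e n = ⊛-cong-upto f f' g g n (λ i _ → e i) (λ _ _ → refl)

⊛-congʳ : ∀ f {g g'} → g ≈ g' → (f ⊛ g) ≈ (f ⊛ g')
⊛-congʳ f {g} {g'} e n = ⊛-cong-upto f f g g' n (λ _ _ → refl) (λ i _ → e i)

⊛-comm : ∀ f g → (f ⊛ g) ≈ (g ⊛ f)
⊛-comm f g n = begin
  (f ⊛ g) n                                                   ≡⟨ ⊛-as-δ-sum f g n n NP.≤-refl ⟩
  ΣR 0 n (λ i → ΣR 0 n (λ j → δ (i ℕ.+ j) n * (f i * g j)))  ≡⟨ ΣR-swap 0 n 0 n _ ⟩
  ΣR 0 n (λ j → ΣR 0 n (λ i → δ (i ℕ.+ j) n * (f i * g j)))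
    ≡⟨ ΣR-cong 0 n (λ j _ _ → ΣR-cong 0 n (λ i _ _ →
         cong₂ _*_ (cong (λ z → δ z n) (NP.+-comm i j)) (ZP.*-comm (f i) (g j)))) ⟩
  ΣR 0 n (λ j → ΣR 0 n (λ i → δ (j ℕ.+ i) n * (g j * f i)))  ≡⟨ sym (⊛-as-δ-sum g f n n NP.≤-refl) ⟩
  (g ⊛ f) n                                                   ∎

⊛-identityʳ : ∀ f → (f ⊛ one) ≈ f
⊛-identityʳ f n = trans (⊛-as-ΣR f one n)
  (trans (ΣR-single 0 n n _ z≤n NP.≤-refl (λ i _ i≤n i≢n → trans (cong (f i *_) (one-pos i i≤n i≢n)) (ZP.*-zeroʳ (f i))))
    (trans (cong (λ z → f n * one z) (NP.n∸n≡0 n)) (ZP.*-identityʳ (f n))))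
  where
  one-pos : ∀ i → i ≤ n → i ≢ n → one (n ∸ i) ≡ + 0
  one-pos i i≤n i≢n with n ∸ i in eq
  ... | zero  = ⊥-elim (i≢n (NP.≤-antisym i≤n (NP.m∸n≡0⇒m≤n eq)))
  ... | suc _ = refl

⊛-identityˡ : ∀ f → (one ⊛ f) ≈ f
⊛-identityˡ f n = trans (⊛-comm one f n) (⊛-identityʳ f n)

-- Associativity goes through the symmetric normal form
--   [q^n] (f g) h = Σ_{a, b, c ≤ n} [a + b + c = n] f_a g_b h_c,
-- which is invariant under rotating (f, g, h); with commutativity this
-- gives f (g h) = (g h) f = (f g) h.
tripleSum : Series → Series → Series → ℕ → ℤ
tripleSum f g h n = ΣR 0 n (λ a → ΣR 0 n (λ b → ΣR 0 n (λ c → δ (a ℕ.+ b ℕ.+ c) n * (f a * g b * h c))))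

-- summing out the middle index of (f g) h: either a + b ≤ n and exactly
-- one i = a + b and one c = n - i contribute, or no term does
⊛⊛-inner : ∀ (f g h : Series) n a b →
  ΣR 0 n (λ i → δ (a ℕ.+ b) i * (f a * g b) * h (n ∸ i)) ≡ ΣR 0 n (λ c → δ (a ℕ.+ b ℕ.+ c) n * (f a * g b * h c))
⊛⊛-inner f g h n a b with a ℕ.+ b NP.≤? n
... | yes ab≤n = trans
  (trans (ΣR-single 0 n (a ℕ.+ b) _ z≤n ab≤n (λ i _ _ i≢ →
            trans (cong (_* h (n ∸ i)) (δ*-miss (a ℕ.+ b) i (f a * g b) (i≢ ∘ sym))) (ZP.*-zeroˡ (h (n ∸ i)))))
         (cong (_* h (n ∸ (a ℕ.+ b))) (δ*-hit (a ℕ.+ b) (a ℕ.+ b) (f a * g b) refl)))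
  (sym (trans (ΣR-single 0 n (n ∸ (a ℕ.+ b)) _ z≤n (NP.m∸n≤m n (a ℕ.+ b))
                (λ c _ _ c≢ → δ*-miss (a ℕ.+ b ℕ.+ c) n (f a * g b * h c)
                                (λ e → c≢ (trans (sym (NP.m+n∸m≡n (a ℕ.+ b) c)) (cong (_∸ (a ℕ.+ b)) e)))))
              (δ*-hit (a ℕ.+ b ℕ.+ (n ∸ (a ℕ.+ b))) n _ (NP.m+[n∸m]≡n ab≤n))))
... | no ab≰n = trans
  (ΣR-zero 0 n (λ i _ i≤n → trans
     (cong (_* h (n ∸ i)) (δ*-miss (a ℕ.+ b) i (f a * g b) (λ e → ab≰n (subst (_≤ n) (sym e) i≤n))))
     (ZP.*-zeroˡ (h (n ∸ i)))))
  (sym (ΣR-zero 0 n (λ c _ _ → δ*-miss (a ℕ.+ b ℕ.+ c) n (f a * g b * h c)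
                                 (λ e → ab≰n (subst (a ℕ.+ b ≤_) e (NP.m≤m+n (a ℕ.+ b) c))))))

⊛⊛-as-tripleSum : ∀ f g h n → ((f ⊛ g) ⊛ h) n ≡ tripleSum f g h n
⊛⊛-as-tripleSum f g h n = begin
  ((f ⊛ g) ⊛ h) n
    ≡⟨ ⊛-as-ΣR (f ⊛ g) h n ⟩
  ΣR 0 n (λ i → (f ⊛ g) i * h (n ∸ i))
    ≡⟨ ΣR-cong 0 n (λ i _ i≤n → trans (cong (_* h (n ∸ i)) (⊛-as-δ-sum f g i n i≤n)) (distribute i)) ⟩
  ΣR 0 n (λ i → ΣR 0 n (λ a → ΣR 0 n (λ b → term i a b)))
    ≡⟨ ΣR-swap 0 n 0 n (λ i a → ΣR 0 n (term i a)) ⟩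
  ΣR 0 n (λ a → ΣR 0 n (λ i → ΣR 0 n (λ b → term i a b)))
    ≡⟨ ΣR-cong 0 n (λ a _ _ → ΣR-swap 0 n 0 n (λ i b → term i a b)) ⟩
  ΣR 0 n (λ a → ΣR 0 n (λ b → ΣR 0 n (λ i → term i a b)))
    ≡⟨ ΣR-cong 0 n (λ a _ _ → ΣR-cong 0 n (λ b _ _ → ⊛⊛-inner f g h n a b)) ⟩
  tripleSum f g h n ∎
  where
  term : ℕ → ℕ → ℕ → ℤ
  term i a b = δ (a ℕ.+ b) i * (f a * g b) * h (n ∸ i)
  distribute : ∀ i → ΣR 0 n (λ a → ΣR 0 n (λ b → δ (a ℕ.+ b) i * (f a * g b))) * h (n ∸ i)
                   ≡ ΣR 0 n (λ a → ΣR 0 n (λ b → term i a b))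
  distribute i = trans (ΣR-*ʳ 0 n (h (n ∸ i)) _) (ΣR-cong 0 n (λ a _ _ → ΣR-*ʳ 0 n (h (n ∸ i)) _))

tripleSum-rotate : ∀ f g h n → tripleSum f g h n ≡ tripleSum g h f n
tripleSum-rotate f g h n = begin
  tripleSum f g h n
    ≡⟨ ΣR-swap 0 n 0 n (λ a b → ΣR 0 n (term a b)) ⟩
  ΣR 0 n (λ b → ΣR 0 n (λ a → ΣR 0 n (λ c → term a b c)))
    ≡⟨ ΣR-cong 0 n (λ b _ _ → ΣR-swap 0 n 0 n (λ a c → term a b c)) ⟩
  ΣR 0 n (λ b → ΣR 0 n (λ c → ΣR 0 n (λ a → term a b c)))
    ≡⟨ ΣR-cong 0 n (λ b _ _ → ΣR-cong 0 n (λ c _ _ → ΣR-cong 0 n (λ a _ _ →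
         cong₂ _*_ (cong (λ z → δ z n) (rotateℕ a b c)) (rotateℤ (f a) (g b) (h c))))) ⟩
  tripleSum g h f n ∎
  where
  term : ℕ → ℕ → ℕ → ℤ
  term a b c = δ (a ℕ.+ b ℕ.+ c) n * (f a * g b * h c)
  rotateℕ : ∀ a b c → a ℕ.+ b ℕ.+ c ≡ b ℕ.+ c ℕ.+ a
  rotateℕ a b c = trans (NP.+-assoc a b c) (NP.+-comm a (b ℕ.+ c))
  rotateℤ : ∀ x y z → x * y * z ≡ y * z * x
  rotateℤ = solve-∀

⊛-assoc : ∀ f g h → ((f ⊛ g) ⊛ h) ≈ (f ⊛ (g ⊛ h))
⊛-assoc f g h n = begin
  ((f ⊛ g) ⊛ h) n    ≡⟨ ⊛⊛-as-tripleSum f g h n ⟩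
  tripleSum f g h n  ≡⟨ tripleSum-rotate f g h n ⟩
  tripleSum g h f n  ≡⟨ sym (⊛⊛-as-tripleSum g h f n) ⟩
  ((g ⊛ h) ⊛ f) n    ≡⟨ ⊛-comm (g ⊛ h) f n ⟩
  (f ⊛ (g ⊛ h)) n    ∎

⊛-interchange : ∀ a b c d → ((a ⊛ b) ⊛ (c ⊛ d)) ≈ ((a ⊛ c) ⊛ (b ⊛ d))
⊛-interchange a b c d =
  ≈-trans (⊛-assoc a b (c ⊛ d))
  (≈-trans (⊛-congʳ a (≈-sym (⊛-assoc b c d)))
  (≈-trans (⊛-congʳ a (⊛-congˡ d (⊛-comm b c)))
  (≈-trans (⊛-congʳ a (⊛-assoc c b d))
           (≈-sym (⊛-assoc a c (b ⊛ d))))))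

-- Geometric series and Euler's identity (q;q)_∞ · Σ p(m) q^m = 1

-- geo s = 1/(1 - q^s) = Σ_t q^{s t}: its coefficients are [s ∣ i]
geo : ℕ → Series
geo s i = 𝟙 (does (s ∣? i))

oneMinusQ^-as-δ : ∀ s i → oneMinusQ^ (suc s) i ≡ δ i 0 - δ i (suc s)
oneMinusQ^-as-δ s zero    = refl
oneMinusQ^-as-δ s (suc i) = negated (does (suc i ≟ suc s))
  where
  negated : ∀ b → (if b then - (+ 1) else + 0) ≡ + 0 - 𝟙 b
  negated true  = refl
  negated false = refl

geo-recurrence : ∀ s n → geo (suc s) n - ΣR 0 n (λ i → δ i (suc s) * geo (suc s) (n ∸ i)) ≡ one n
geo-recurrence s zero = cong (_-_ (geo (suc s) 0)) (ΣR-δ-out 0 (suc s) _ (s≤s z≤n))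
geo-recurrence s (suc n) with suc s NP.≤? suc n
... | yes s≤n = trans (cong (_-_ (geo (suc s) (suc n))) (ΣR-δ-in (suc n) (suc s) _ s≤n)) (cancel (suc s ∣? suc n))
  where
  cancel : (D : Dec (suc s ∣ suc n)) → 𝟙 (does D) - geo (suc s) (suc n ∸ suc s) ≡ + 0
  cancel (yes d) = cong (_-_ (+ 1)) (𝟙-yes (suc s ∣? (suc n ∸ suc s))
    (∣m+n∣m⇒∣n (subst (suc s ∣_) (sym (NP.m+[n∸m]≡n s≤n)) d) n∣n))
  cancel (no ¬d) = cong (_-_ (+ 0)) (𝟙-no (suc s ∣? (suc n ∸ suc s)) (λ d → ¬d (∣m∸n∣n⇒∣m (suc s) s≤n d n∣n)))
... | no s≰n = cong₂ _-_ (𝟙-no (suc s ∣? suc n) (s≰n ∘ ∣⇒≤)) (ΣR-δ-out (suc n) (suc s) _ (NP.≰⇒> s≰n))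

oneMinusQ^-⊛-geo : ∀ s → (oneMinusQ^ (suc s) ⊛ geo (suc s)) ≈ one
oneMinusQ^-⊛-geo s n = begin
  (oneMinusQ^ (suc s) ⊛ geo (suc s)) n
    ≡⟨ ⊛-as-ΣR (oneMinusQ^ (suc s)) (geo (suc s)) n ⟩
  ΣR 0 n (λ i → oneMinusQ^ (suc s) i * G (n ∸ i))
    ≡⟨ ΣR-cong 0 n (λ i _ _ → trans (cong (_* G (n ∸ i)) (oneMinusQ^-as-δ s i)) (distrib (δ i 0) (δ i (suc s)) (G (n ∸ i)))) ⟩
  ΣR 0 n (λ i → δ i 0 * G (n ∸ i) + - (δ i (suc s) * G (n ∸ i)))
    ≡⟨ ΣR-+ 0 n _ _ ⟩
  ΣR 0 n (λ i → δ i 0 * G (n ∸ i)) + ΣR 0 n (λ i → - (δ i (suc s) * G (n ∸ i)))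
    ≡⟨ cong₂ _+_ (ΣR-δ-in n 0 (λ i → G (n ∸ i)) z≤n) (sym (ΣR-neg 0 n _)) ⟩
  G n - ΣR 0 n (λ i → δ i (suc s) * G (n ∸ i))
    ≡⟨ geo-recurrence s n ⟩
  one n ∎
  where
  G = geo (suc s)
  distrib : ∀ x y z → (x - y) * z ≡ x * z + - (y * z)
  distrib = solve-∀

invQQ : ℕ → Series
invQQ zero    = one
invQQ (suc N) = invQQ N ⊛ geo (suc N)

qqUpTo-⊛-invQQ : ∀ N → (qqUpTo N ⊛ invQQ N) ≈ one
qqUpTo-⊛-invQQ zero    = ⊛-identityˡ one
qqUpTo-⊛-invQQ (suc N) =
  ≈-trans (⊛-interchange (qqUpTo N) (oneMinusQ^ (suc N)) (invQQ N) (geo (suc N)))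
  (≈-trans (⊛-congˡ (oneMinusQ^ (suc N) ⊛ geo (suc N)) (qqUpTo-⊛-invQQ N))
  (≈-trans (⊛-identityˡ (oneMinusQ^ (suc N) ⊛ geo (suc N)))
           (oneMinusQ^-⊛-geo N)))

-- A factor that is 1 up to degree k does not change coefficients up to k;
-- hence coefficient k of qqUpTo N and of invQQ N is the same for all N ≥ k.
geo-low : ∀ s i → i < s → geo s i ≡ one i
geo-low s zero    i<s = 𝟙-yes (s ∣? 0) (divides 0 refl)
geo-low s (suc i) i<s = 𝟙-no (s ∣? suc i) (λ d → NP.<⇒≱ i<s (∣⇒≤ d))

oneMinusQ^-low : ∀ M x → x < suc M → oneMinusQ^ (suc M) x ≡ one x
oneMinusQ^-low M zero    _         = refl
oneMinusQ^-low M (suc x) (s≤s x<M) =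
  cong (λ b → if b then - (+ 1) else + 0) (dec-false (suc x ≟ suc M) (NP.<⇒≢ x<M ∘ NP.suc-injective))

stable-product : (F : ℕ → Series) (factor : ℕ → Series) →
  (∀ N → F (suc N) ≈ (F N ⊛ factor (suc N))) → (∀ M x → x < suc M → factor (suc M) x ≡ one x) →
  ∀ k d → F (k ℕ.+ d) k ≡ F k k
stable-product F factor step low k zero    = cong (λ z → F z k) (NP.+-identityʳ k)
stable-product F factor step low k (suc d) = begin
  F (k ℕ.+ suc d) k                   ≡⟨ cong (λ z → F z k) (NP.+-suc k d) ⟩
  F (suc (k ℕ.+ d)) k                 ≡⟨ step (k ℕ.+ d) k ⟩
  (F (k ℕ.+ d) ⊛ factor (suc (k ℕ.+ d))) k
    ≡⟨ ⊛-cong-upto (F (k ℕ.+ d)) (F (k ℕ.+ d)) (factor (suc (k ℕ.+ d))) one k (λ _ _ → refl)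
                   (λ i i≤k → low (k ℕ.+ d) i (s≤s (NP.≤-trans i≤k (NP.m≤m+n k d)))) ⟩
  (F (k ℕ.+ d) ⊛ one) k               ≡⟨ ⊛-identityʳ (F (k ℕ.+ d)) k ⟩
  F (k ℕ.+ d) k                       ≡⟨ stable-product F factor step low k d ⟩
  F k k                               ∎

stable-at : (F : ℕ → Series) → (∀ k d → F (k ℕ.+ d) k ≡ F k k) → ∀ m i → i ≤ m → F m i ≡ F i i
stable-at F stable m i i≤m = trans (cong (λ z → F z i) (sym (NP.m+[n∸m]≡n i≤m))) (stable i (m ∸ i))

qqUpTo-stable : ∀ m i → i ≤ m → qqUpTo m i ≡ qq∞ i
qqUpTo-stable = stable-at qqUpTo (stable-product qqUpTo oneMinusQ^ (λ _ _ → refl) oneMinusQ^-low)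

invQQ-stable : ∀ m i → i ≤ m → invQQ m i ≡ invQQ i i
invQQ-stable = stable-at invQQ (stable-product invQQ geo (λ _ _ → refl) (λ M x → geo-low (suc M) x))

-- geoFrom s l = ∏_{m=s}^{s+l-1} 1/(1 - q^m), built from the left so that it
-- follows the recursion of the multiplicity vectors in Defs.lists
geoFrom : ℕ → ℕ → Series
geoFrom s zero    = one
geoFrom s (suc l) = geo s ⊛ geoFrom (suc s) l

geoFrom-snoc : ∀ s l → geoFrom s (suc l) ≈ (geoFrom s l ⊛ geo (s ℕ.+ l))
geoFrom-snoc s zero =
  ≈-trans (⊛-identityʳ (geo s))
  (≈-trans (λ n → cong (λ z → geo z n) (sym (NP.+-identityʳ s))) (≈-sym (⊛-identityˡ (geo (s ℕ.+ 0)))))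
geoFrom-snoc s (suc l) =
  ≈-trans (⊛-congʳ (geo s) (geoFrom-snoc (suc s) l))
  (≈-trans (≈-sym (⊛-assoc (geo s) (geoFrom (suc s) l) (geo (suc s ℕ.+ l))))
           (⊛-congʳ (geoFrom s (suc l)) (λ n → cong (λ z → geo z n) (sym (NP.+-suc s l)))))

geoFrom-1 : ∀ N → geoFrom 1 N ≈ invQQ N
geoFrom-1 zero    n = refl
geoFrom-1 (suc N) = ≈-trans (geoFrom-snoc 1 N) (⊛-congˡ (geo (suc N)) (geoFrom-1 N))

countWeighted : ℕ → ℕ → ℕ → ℕ → ℤ
countWeighted l b s m = ΣL (lists l b) (λ c → δ (weight s c) m)

δ-shift : ∀ k w m → k ≤ m → δ (k ℕ.+ w) m ≡ δ w (m ∸ k)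
δ-shift k w m k≤m with w ≟ m ∸ k
... | yes refl = trans (cong (λ z → δ z m) (NP.m+[n∸m]≡n k≤m)) (trans (δ-refl m) (sym (δ-refl (m ∸ k))))
... | no ne    = trans (δ-no (k ℕ.+ w) m (λ e → ne (trans (sym (NP.m+n∸m≡n k w)) (cong (_∸ k) e))))
                       (sym (δ-no w (m ∸ k) ne))

δ-shift-out : ∀ k w m → ¬ k ≤ m → δ (k ℕ.+ w) m ≡ + 0
δ-shift-out k w m k≰m = δ-no (k ℕ.+ w) m (λ e → k≰m (subst (k ≤_) e (NP.m≤m+n k w)))

geo-as-δ-sum : ∀ s i b → i ≤ b → geo (suc s) i ≡ ΣR 0 b (λ c → δ (suc s ℕ.* c) i)
geo-as-δ-sum s i b i≤b = by-cases (suc s ∣? i)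
  where
  by-cases : (D : Dec (suc s ∣ i)) → 𝟙 (does D) ≡ ΣR 0 b (λ c → δ (suc s ℕ.* c) i)
  by-cases (yes (divides q eq)) = sym (trans
    (ΣR-single 0 b q _ z≤n (NP.≤-trans (subst (q ≤_) (sym eq) (NP.m≤m*n q (suc s))) i≤b)
      (λ c _ _ c≢ → δ-no (suc s ℕ.* c) i (λ e → c≢ (NP.*-cancelˡ-≡ c q (suc s) (trans e (trans eq (NP.*-comm q (suc s))))))))
    (trans (cong (λ z → δ z i) (trans (NP.*-comm (suc s) q) (sym eq))) (δ-refl i)))
  by-cases (no ¬d) = sym (ΣR-zero 0 b (λ c _ _ → δ-no (suc s ℕ.* c) i (λ e → ¬d (divides c (trans (sym e) (NP.*-comm (suc s) c))))))

-- Splitting off the first multiplicity c of a vector: it contributes the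
-- weight s c, so the count is the convolution of [s ∣ ·] with the count of
-- the remaining vectors.
countWeighted-geoFrom : ∀ l b s m → m ≤ b → countWeighted l b (suc s) m ≡ geoFrom (suc s) l m
countWeighted-geoFrom zero    b s zero    m≤b = refl
countWeighted-geoFrom zero    b s (suc m) m≤b = refl
countWeighted-geoFrom (suc l) b s m m≤b = begin
  countWeighted (suc l) b (suc s) m
    ≡⟨ ΣL-concatMap (λ c → map (c ∷_) (lists l b)) (upTo (suc b)) (λ cs → δ (weight (suc s) cs) m) ⟩
  ΣL (upTo (suc b)) (λ c → ΣL (map (c ∷_) (lists l b)) (λ cs → δ (weight (suc s) cs) m))
    ≡⟨ ΣL-cong (upTo (suc b)) (λ c → ΣL-map (c ∷_) (lists l b) (λ cs → δ (weight (suc s) cs) m)) ⟩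
  ΣL (upTo (suc b)) (λ c → rest c)
    ≡⟨ ΣL-upTo b rest ⟩
  ΣR 0 b rest
    ≡⟨ ΣR-cong 0 b (λ c _ _ → rest-as-sum c) ⟩
  ΣR 0 b (λ c → ΣR 0 m (λ i → δ (suc s ℕ.* c) i * G (m ∸ i)))
    ≡⟨ ΣR-swap 0 b 0 m _ ⟩
  ΣR 0 m (λ i → ΣR 0 b (λ c → δ (suc s ℕ.* c) i * G (m ∸ i)))
    ≡⟨ ΣR-cong 0 m (λ i _ i≤m → trans (sym (ΣR-*ʳ 0 b (G (m ∸ i)) _))
                                     (cong (_* G (m ∸ i)) (sym (geo-as-δ-sum s i b (NP.≤-trans i≤m m≤b))))) ⟩
  ΣR 0 m (λ i → geo (suc s) i * G (m ∸ i))
    ≡⟨ sym (⊛-as-ΣR (geo (suc s)) G m) ⟩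
  geoFrom (suc s) (suc l) m ∎
  where
  G = geoFrom (suc (suc s)) l
  rest : ℕ → ℤ
  rest c = ΣL (lists l b) (λ cs → δ (suc s ℕ.* c ℕ.+ weight (suc (suc s)) cs) m)
  rest-as-sum : ∀ c → rest c ≡ ΣR 0 m (λ i → δ (suc s ℕ.* c) i * G (m ∸ i))
  rest-as-sum c with suc s ℕ.* c NP.≤? m
  ... | yes sc≤m = begin
    rest c
      ≡⟨ ΣL-cong (lists l b) (λ cs → δ-shift (suc s ℕ.* c) (weight (suc (suc s)) cs) m sc≤m) ⟩
    countWeighted l b (suc (suc s)) (m ∸ suc s ℕ.* c)
      ≡⟨ countWeighted-geoFrom l b (suc s) (m ∸ suc s ℕ.* c) (NP.≤-trans (NP.m∸n≤m m (suc s ℕ.* c)) m≤b) ⟩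
    G (m ∸ suc s ℕ.* c)
      ≡⟨ sym (trans (ΣR-single 0 m (suc s ℕ.* c) (λ i → δ (suc s ℕ.* c) i * G (m ∸ i)) z≤n sc≤m
                      (λ i _ _ i≢ → δ*-miss (suc s ℕ.* c) i (G (m ∸ i)) (i≢ ∘ sym)))
                    (δ*-hit (suc s ℕ.* c) (suc s ℕ.* c) (G (m ∸ suc s ℕ.* c)) refl)) ⟩
    ΣR 0 m (λ i → δ (suc s ℕ.* c) i * G (m ∸ i)) ∎
  ... | no sc≰m = trans (ΣL-cong (lists l b) (λ cs → δ-shift-out (suc s ℕ.* c) (weight (suc (suc s)) cs) m sc≰m))
    (trans (ΣL-0 (lists l b))
      (sym (ΣR-zero 0 m (λ i _ i≤m → δ*-miss (suc s ℕ.* c) i (G (m ∸ i)) (λ e → sc≰m (subst (_≤ m) (sym e) i≤m))))))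

p-as-invQQ : ∀ j → + p j ≡ invQQ j j
p-as-invQQ j = trans (length-filter (λ c → weight 1 c ≟ j) (lists j j))
  (trans (countWeighted-geoFrom j j 0 j NP.≤-refl) (geoFrom-1 j j))

partitionSeries : Series
partitionSeries j = + p j

euler-inverse : ∀ m → (qq∞ ⊛ partitionSeries) m ≡ one m
euler-inverse m = trans
  (⊛-cong-upto qq∞ (qqUpTo m) partitionSeries (invQQ m) m
    (λ i i≤m → sym (qqUpTo-stable m i i≤m))
    (λ j j≤m → trans (p-as-invQQ j) (sym (invQQ-stable m j j≤m))))
  (qqUpTo-⊛-invQQ m m)

∈range⁺ : ∀ {a b x} → a ≤ x → x ≤ b → x ∈ range a b
∈range⁺ {a} {b} a≤x x≤b =
  subst (_∈ range a b) (NP.m+[n∸m]≡n a≤x) (∈-map⁺ (a ℕ.+_) (∈-upTo⁺ (NP.∸-monoˡ-< (s≤s x≤b) a≤x)))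

∈range⁻ : ∀ {a b x} → x ∈ range a b → a ≤ x × x ≤ b
∈range⁻ {a} {b} x∈ with ∈-map⁻ (a ℕ.+_) x∈
... | i , i∈ , refl = NP.m≤m+n a i , range-bound a b i (∈-upTo⁻ i∈)

prime≥2 : ∀ {p} → Prime p → 2 ≤ p
prime≥2 {p} pr = nonTrivial⇒n>1 p {{prime⇒nonTrivial pr}}

prime≥1 : ∀ {p} → Prime p → 1 ≤ p
prime≥1 pr = NP.≤-trans (s≤s z≤n) (prime≥2 pr)

1≤* : ∀ {a b} → 1 ≤ a → 1 ≤ b → 1 ≤ a ℕ.* b
1≤* a≥1 b≥1 = NP.*-mono-≤ a≥1 b≥1

1≤-factor : ∀ x y → 1 ≤ x ℕ.* y → 1 ≤ x
1≤-factor (suc x) y _ = s≤s z≤n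

divisor-≤ : ∀ {m n} → 1 ≤ n → m ∣ n → m ≤ n
divisor-≤ n≥1 d = ∣⇒≤ {{>-nonZero n≥1}} d

prime-divides-cofactor : ∀ {p q} K → Prime p → Prime q → q ≢ p → q ∣ p ℕ.* K → q ∣ K
prime-divides-cofactor {p} {q} K pp pq q≢p d with euclidsLemma p K pq d
... | inj₂ q∣K = q∣K
... | inj₁ q∣p with prime⇒irreducible pp q∣p
...   | inj₁ q≡1 = ⊥-elim (nonTrivial⇒≢1 {{prime⇒nonTrivial pq}} q≡1)
...   | inj₂ q≡p = ⊥-elim (q≢p q≡p)

coprime-of-ndvd : ∀ {p u} → Prime p → ¬ p ∣ u → Coprime u p
coprime-of-ndvd pp p∤u (i∣u , i∣p) with prime⇒irreducible pp i∣p
... | inj₁ i≡1  = i≡1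
... | inj₂ refl = ⊥-elim (p∤u i∣u)

ωTerm : ℕ → ℕ → ℤ
ωTerm n q = 𝟙 (does (prime? q ×-dec q ∣? n))

ω-sum : ∀ n → + ω n ≡ ΣR 1 n (ωTerm n)
ω-sum n = trans (length-filter (λ q → prime? q ×-dec q ∣? n) (range 1 n)) (sym (ΣR-as-ΣL 1 n (ωTerm n)))

ωTerm-shrink : ∀ K K' → 1 ≤ K → K ≤ K' → ΣR 1 K' (ωTerm K) ≡ ΣR 1 K (ωTerm K)
ωTerm-shrink K K' K≥1 K≤K' = sym (ΣR-ext 1 K K' (ωTerm K) K≤K'
  (λ q K<q _ → 𝟙-no (prime? q ×-dec q ∣? K) (λ (_ , q∣K) → NP.<⇒≱ K<q (divisor-≤ K≥1 q∣K))))

ωTerm-other : ∀ p K q → Prime p → q ≢ p → ωTerm (p ℕ.* K) q ≡ ωTerm K q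
ωTerm-other p K q pp q≢p = cong 𝟙 (does-iff (prime? q ×-dec q ∣? (p ℕ.* K)) (prime? q ×-dec q ∣? K)
  (λ (pq , d) → pq , prime-divides-cofactor K pp pq q≢p d) (λ (pq , q∣K) → pq , ∣n⇒∣m*n p q∣K))

-- ω(p K) = ω(K) + [p ∣ p K] - [p ∣ K]: only the prime p can change status
ω-mul-prime : ∀ p K → Prime p → 1 ≤ K → + ω (p ℕ.* K) ≡ + ω K + (ωTerm (p ℕ.* K) p - ωTerm K p)
ω-mul-prime p K pp K≥1 = begin
  + ω (p ℕ.* K)                                                  ≡⟨ ω-sum (p ℕ.* K) ⟩
  ΣR 1 (p ℕ.* K) (ωTerm (p ℕ.* K))                               ≡⟨ ΣR-cong 1 (p ℕ.* K) (λ q _ _ → split q) ⟩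
  ΣR 1 (p ℕ.* K) (λ q → ωTerm K q + δ q p * jump)                ≡⟨ ΣR-+ 1 (p ℕ.* K) _ _ ⟩
  ΣR 1 (p ℕ.* K) (ωTerm K) + ΣR 1 (p ℕ.* K) (λ q → δ q p * jump)
    ≡⟨ cong₂ _+_ (ωTerm-shrink K (p ℕ.* K) K≥1 (NP.m≤n*m K p {{>-nonZero (prime≥1 pp)}}))
                 (ΣR-single 1 (p ℕ.* K) p _ (prime≥1 pp) (NP.m≤m*n p K {{>-nonZero K≥1}}) (λ q _ _ q≢ → δ*-miss q p jump q≢)) ⟩
  ΣR 1 K (ωTerm K) + δ p p * jump                                ≡⟨ cong₂ _+_ (sym (ω-sum K)) (δ*-hit p p jump refl) ⟩
  + ω K + jump                                                   ∎
  where
  jump = ωTerm (p ℕ.* K) p - ωTerm K p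
  split : ∀ q → ωTerm (p ℕ.* K) q ≡ ωTerm K q + δ q p * jump
  split q with q ≟ p
  ... | yes refl = sym (trans (cong (_+_ (ωTerm K q)) (δ*-hit q q jump refl)) (cancel (ωTerm K q) (ωTerm (q ℕ.* K) q)))
    where
    cancel : ∀ a b → a + (b - a) ≡ b
    cancel = solve-∀
  ... | no q≢p = trans (ωTerm-other p K q pp q≢p)
                       (sym (trans (cong (_+_ (ωTerm K q)) (δ*-miss q p jump q≢p)) (ZP.+-identityʳ _)))

ωTerm-self : ∀ p K → Prime p → ωTerm (p ℕ.* K) p ≡ + 1
ωTerm-self p K pp = 𝟙-yes (prime? p ×-dec p ∣? (p ℕ.* K)) (pp , m∣m*n K)

ω-dvd : ∀ p K → Prime p → 1 ≤ K → p ∣ K → ω (p ℕ.* K) ≡ ω K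
ω-dvd p K pp K≥1 p∣K = ZP.+-injective (begin
  + ω (p ℕ.* K)                              ≡⟨ ω-mul-prime p K pp K≥1 ⟩
  + ω K + (ωTerm (p ℕ.* K) p - ωTerm K p)    ≡⟨ cong (_+_ (+ ω K)) (cong₂ _-_ (ωTerm-self p K pp) old) ⟩
  + ω K + + 0                                ≡⟨ ZP.+-identityʳ _ ⟩
  + ω K                                      ∎)
  where
  old : ωTerm K p ≡ + 1
  old = 𝟙-yes (prime? p ×-dec p ∣? K) (pp , p∣K)

ω-ndvd : ∀ p K → Prime p → 1 ≤ K → ¬ p ∣ K → ω (p ℕ.* K) ≡ suc (ω K)
ω-ndvd p K pp K≥1 p∤K = ZP.+-injective (begin
  + ω (p ℕ.* K)                              ≡⟨ ω-mul-prime p K pp K≥1 ⟩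
  + ω K + (ωTerm (p ℕ.* K) p - ωTerm K p)    ≡⟨ cong (_+_ (+ ω K)) (cong₂ _-_ (ωTerm-self p K pp) new) ⟩
  + ω K + + 1                                ≡⟨ sym (ZP.pos-+ (ω K) 1) ⟩
  + (ω K ℕ.+ 1)                              ≡⟨ cong +_ (NP.+-comm (ω K) 1) ⟩
  + suc (ω K)                                ∎)
  where
  new : ωTerm K p ≡ + 0
  new = 𝟙-no (prime? p ×-dec p ∣? K) (p∤K ∘ proj₂)

squareDivisor? : (n : ℕ) → Dec (Any (λ d → (d ℕ.* d) ∣ n) (range 2 n))
squareDivisor? n = any? (λ d → (d ℕ.* d) ∣? n) (range 2 n)

squarefree-mul-prime : ∀ p v → Prime p → 1 ≤ v → ¬ p ∣ v → Squarefree? (p ℕ.* v) ≡ Squarefree? v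
squarefree-mul-prime p v pp v≥1 p∤v = cong not (does-iff (squareDivisor? (p ℕ.* v)) (squareDivisor? v) down up)
  where
  down : Any (λ d → (d ℕ.* d) ∣ p ℕ.* v) (range 2 (p ℕ.* v)) → Any (λ d → (d ℕ.* d) ∣ v) (range 2 v)
  down a with find a
  ... | d , d∈ , dd∣ = lose (∈range⁺ d≥2 d≤v) dd∣v
    where
    d≥2 = proj₁ (∈range⁻ {2} {p ℕ.* v} d∈)
    p∤dd : ¬ p ∣ d ℕ.* d
    p∤dd p∣dd with euclidsLemma d d pp p∣dd
    ... | inj₁ p∣d = p∤v (*-cancelˡ-∣ p {{>-nonZero (prime≥1 pp)}} (∣-trans (*-pres-∣ p∣d p∣d) dd∣))
    ... | inj₂ p∣d = p∤v (*-cancelˡ-∣ p {{>-nonZero (prime≥1 pp)}} (∣-trans (*-pres-∣ p∣d p∣d) dd∣))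
    dd∣v : (d ℕ.* d) ∣ v
    dd∣v = coprime-divisor (coprime-of-ndvd pp p∤dd) dd∣
    d≤v : d ≤ v
    d≤v = NP.≤-trans (NP.m≤m*n d d {{>-nonZero (NP.≤-trans (s≤s z≤n) d≥2)}}) (divisor-≤ v≥1 dd∣v)
  up : Any (λ d → (d ℕ.* d) ∣ v) (range 2 v) → Any (λ d → (d ℕ.* d) ∣ p ℕ.* v) (range 2 (p ℕ.* v))
  up a with find a
  ... | d , d∈ , dd∣ = lose (∈range⁺ (proj₁ (∈range⁻ {2} {v} d∈))
                               (NP.≤-trans (proj₂ (∈range⁻ {2} {v} d∈)) (NP.m≤n*m v p {{>-nonZero (prime≥1 pp)}})))
                             (∣n⇒∣m*n p dd∣)

squarefree-false : ∀ p u → Prime p → 1 ≤ u → (p ℕ.* p) ∣ u → Squarefree? u ≡ false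
squarefree-false p u pp u≥1 pp∣u = cong not (dec-true (squareDivisor? u) (lose (∈range⁺ (prime≥2 pp) p≤u) pp∣u))
  where
  p≤u : p ≤ u
  p≤u = NP.≤-trans (NP.m≤m*n p p {{>-nonZero (prime≥1 pp)}}) (divisor-≤ u≥1 pp∣u)

μf : Bool → ℕ → ℤ
μf b k = if b then (- (+ 1)) ℤ.^ k else + 0

μ-mul-prime : ∀ p v → Prime p → 1 ≤ v → ¬ p ∣ v → μ (p ℕ.* v) ≡ - μ v
μ-mul-prime p v pp v≥1 p∤v =
  trans (cong₂ μf (squarefree-mul-prime p v pp v≥1 p∤v) (ω-ndvd p v pp v≥1 p∤v)) (flip (Squarefree? v))
  where
  neg1 : ∀ x → - (+ 1) * x ≡ - x
  neg1 = solve-∀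
  flip : ∀ b → μf b (suc (ω v)) ≡ - μf b (ω v)
  flip true  = neg1 _
  flip false = refl

μ-square-factor : ∀ p u → Prime p → 1 ≤ u → (p ℕ.* p) ∣ u → μ u ≡ + 0
μ-square-factor p u pp u≥1 d = cong (λ b → μf b (ω u)) (squarefree-false p u pp u≥1 d)

absμ : ℕ → ℤ
absμ u = + ∣ μ u ∣

-- Divisor sums of μ and |μ|

𝟙∣ : ℕ → ℕ → ℤ
𝟙∣ u K = 𝟙 (does (u ∣? K))

Σ∣ : ℕ → (ℕ → ℤ) → ℤ
Σ∣ K f = ΣR 1 K (λ u → 𝟙∣ u K * f u)

Σ∣-cong : ∀ K {f g : ℕ → ℤ} → (∀ u → 1 ≤ u → u ∣ K → f u ≡ g u) → Σ∣ K f ≡ Σ∣ K g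
Σ∣-cong K {f} {g} h = ΣR-cong 1 K pointwise
  where
  pointwise : ∀ u → 1 ≤ u → u ≤ K → 𝟙∣ u K * f u ≡ 𝟙∣ u K * g u
  pointwise u u≥1 _ with u ∣? K
  ... | yes d = cong (+ 1 *_) (h u u≥1 d)
  ... | no _  = refl

Σ∣-zero : ∀ K {f : ℕ → ℤ} → (∀ u → 1 ≤ u → u ∣ K → f u ≡ + 0) → Σ∣ K f ≡ + 0
Σ∣-zero K h = trans (Σ∣-cong K h) (ΣR-zero 1 K (λ u _ _ → ZP.*-zeroʳ (𝟙∣ u K)))

Σ∣-neg : ∀ K (f : ℕ → ℤ) → Σ∣ K (λ u → - f u) ≡ - Σ∣ K f
Σ∣-neg K f = trans (ΣR-cong 1 K (λ u _ _ → sym (ZP.neg-distribʳ-* (𝟙∣ u K) (f u)))) (sym (ΣR-neg 1 K _))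

divides-as-δ-sum : ∀ d K u → 1 ≤ u → u ≤ suc d ℕ.* K → 𝟙 (does (suc d ∣? u)) ≡ ΣR 1 K (λ v → δ (suc d ℕ.* v) u)
divides-as-δ-sum d K u u≥1 u≤ = by-cases (suc d ∣? u)
  where
  by-cases : (D : Dec (suc d ∣ u)) → 𝟙 (does D) ≡ ΣR 1 K (λ v → δ (suc d ℕ.* v) u)
  by-cases (yes (divides q eq)) = sym (trans
    (ΣR-single 1 K q _ q≥1 q≤K (λ c _ _ c≢ → δ-no (suc d ℕ.* c) u
      (λ e → c≢ (NP.*-cancelˡ-≡ c q (suc d) (trans e (trans eq (NP.*-comm q (suc d))))))))
    (trans (cong (λ z → δ z u) (trans (NP.*-comm (suc d) q) (sym eq))) (δ-refl u)))
    where
    q≥1 : 1 ≤ q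
    q≥1 = 1≤-factor q (suc d) (subst (1 ≤_) eq u≥1)
    q≤K : q ≤ K
    q≤K = NP.*-cancelˡ-≤ (suc d) (subst (_≤ suc d ℕ.* K) (trans eq (NP.*-comm q (suc d))) u≤)
  by-cases (no ¬d) = sym (ΣR-zero 1 K (λ c _ _ → δ-no (suc d ℕ.* c) u (λ e → ¬d (divides c (trans (sym e) (NP.*-comm (suc d) c))))))

ΣR-multiples : ∀ d K (g : ℕ → ℤ) →
               ΣR 1 (suc d ℕ.* K) (λ u → 𝟙 (does (suc d ∣? u)) * g u) ≡ ΣR 1 K (λ v → g (suc d ℕ.* v))
ΣR-multiples d K g = begin
  ΣR 1 D (λ u → 𝟙 (does (suc d ∣? u)) * g u)
    ≡⟨ ΣR-cong 1 D (λ u u≥1 u≤ → trans (cong (_* g u) (divides-as-δ-sum d K u u≥1 u≤)) (ΣR-*ʳ 1 K (g u) _)) ⟩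
  ΣR 1 D (λ u → ΣR 1 K (λ v → δ (suc d ℕ.* v) u * g u))
    ≡⟨ ΣR-swap 1 D 1 K _ ⟩
  ΣR 1 K (λ v → ΣR 1 D (λ u → δ (suc d ℕ.* v) u * g u))
    ≡⟨ ΣR-cong 1 K (λ v v≥1 v≤K → trans
         (ΣR-single 1 D (suc d ℕ.* v) _ (NP.≤-trans v≥1 (NP.m≤n*m v (suc d))) (NP.*-monoʳ-≤ (suc d) v≤K)
           (λ u _ _ u≢ → δ*-miss (suc d ℕ.* v) u (g u) (u≢ ∘ sym)))
         (δ*-hit (suc d ℕ.* v) (suc d ℕ.* v) (g (suc d ℕ.* v)) refl)) ⟩
  ΣR 1 K (λ v → g (suc d ℕ.* v)) ∎
  where
  D = suc d ℕ.* K

𝟙∤ : ℕ → ℕ → ℤ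
𝟙∤ p u = 𝟙 (does (¬? (p ∣? u)))

𝟙∤+𝟙∣ : ∀ p u → 𝟙∤ p u + 𝟙 (does (p ∣? u)) ≡ + 1
𝟙∤+𝟙∣ p u with does (p ∣? u)
... | true  = refl
... | false = refl

-- For a prime p:  Σ_{u ∣ p K} f(u) = Σ_{u ∣ K, p ∤ u} f(u) + Σ_{v ∣ K} f(p v).
-- A divisor of p K is either prime to p (then it divides K) or p v, v ∣ K.
Σ∣-split : ∀ d K (f : ℕ → ℤ) → Prime (suc d) → 1 ≤ K →
  Σ∣ (suc d ℕ.* K) f ≡ Σ∣ K (λ u → 𝟙∤ (suc d) u * f u) + Σ∣ K (λ v → f (suc d ℕ.* v))
Σ∣-split d K f pp K≥1 = begin
  ΣR 1 pK (λ u → 𝟙∣ u pK * f u)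
    ≡⟨ ΣR-cong 1 pK (λ u _ _ → split u) ⟩
  ΣR 1 pK (λ u → 𝟙∤ P u * (𝟙∣ u pK * f u) + 𝟙 (does (P ∣? u)) * (𝟙∣ u pK * f u))
    ≡⟨ ΣR-+ 1 pK _ _ ⟩
  ΣR 1 pK (λ u → 𝟙∤ P u * (𝟙∣ u pK * f u)) + ΣR 1 pK (λ u → 𝟙 (does (P ∣? u)) * (𝟙∣ u pK * f u))
    ≡⟨ cong₂ _+_ prime-to-p multiples-of-p ⟩
  Σ∣ K (λ u → 𝟙∤ P u * f u) + Σ∣ K (λ v → f (P ℕ.* v)) ∎
  where
  P  = suc d
  pK = suc d ℕ.* K
  split : ∀ u → 𝟙∣ u pK * f u ≡ 𝟙∤ P u * (𝟙∣ u pK * f u) + 𝟙 (does (P ∣? u)) * (𝟙∣ u pK * f u)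
  split u = sym (trans (sym (ZP.*-distribʳ-+ (𝟙∣ u pK * f u) (𝟙∤ P u) _))
                       (trans (cong (_* (𝟙∣ u pK * f u)) (𝟙∤+𝟙∣ P u)) (ZP.*-identityˡ _)))
  coprime-term : ∀ u → 𝟙∤ P u * (𝟙∣ u pK * f u) ≡ 𝟙∣ u K * (𝟙∤ P u * f u)
  coprime-term u = by-cases (P ∣? u)
    where
    by-cases : (D : Dec (P ∣ u)) → 𝟙 (not (does D)) * (𝟙∣ u pK * f u) ≡ 𝟙∣ u K * (𝟙 (not (does D)) * f u)
    by-cases (yes _) = trans (ZP.*-zeroˡ (𝟙∣ u pK * f u)) (sym (trans (cong (𝟙∣ u K *_) (ZP.*-zeroˡ (f u))) (ZP.*-zeroʳ (𝟙∣ u K))))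
    by-cases (no p∤u) = trans (ZP.*-identityˡ _)
      (trans (cong (λ b → 𝟙 b * f u) (does-iff (u ∣? pK) (u ∣? K) (coprime-divisor (coprime-of-ndvd pp p∤u)) (∣n⇒∣m*n P)))
             (cong (𝟙∣ u K *_) (sym (ZP.*-identityˡ (f u)))))
  prime-to-p : ΣR 1 pK (λ u → 𝟙∤ P u * (𝟙∣ u pK * f u)) ≡ Σ∣ K (λ u → 𝟙∤ P u * f u)
  prime-to-p = trans (ΣR-cong 1 pK (λ u _ _ → coprime-term u))
    (sym (ΣR-ext 1 K pK _ (NP.m≤n*m K P)
      (λ u K<u _ → trans (cong (_* (𝟙∤ P u * f u)) (𝟙-no (u ∣? K) (λ u∣K → NP.<⇒≱ K<u (divisor-≤ K≥1 u∣K))))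
                         (ZP.*-zeroˡ (𝟙∤ P u * f u)))))
  multiples-of-p : ΣR 1 pK (λ u → 𝟙 (does (P ∣? u)) * (𝟙∣ u pK * f u)) ≡ Σ∣ K (λ v → f (P ℕ.* v))
  multiples-of-p = trans (ΣR-multiples d K (λ u → 𝟙∣ u pK * f u))
    (ΣR-cong 1 K (λ v _ _ → cong (λ b → 𝟙 b * f (P ℕ.* v))
      (does-iff ((P ℕ.* v) ∣? pK) (v ∣? K) (*-cancelˡ-∣ P) (*-monoʳ-∣ P))))

Σ∣-new-prime : ∀ p K (f : ℕ → ℤ) → Prime p → 1 ≤ K → ¬ p ∣ K →
               Σ∣ (p ℕ.* K) f ≡ Σ∣ K f + Σ∣ K (λ v → f (p ℕ.* v))
Σ∣-new-prime (suc d) K f pp K≥1 p∤K = trans (Σ∣-split d K f pp K≥1)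
  (cong (_+ Σ∣ K (λ v → f (suc d ℕ.* v)))
    (Σ∣-cong K (λ u u≥1 u∣K → trans (cong (_* f u) (𝟙-yes (¬? (suc d ∣? u)) (λ p∣u → p∤K (∣-trans p∣u u∣K))))
                                     (ZP.*-identityˡ (f u)))))

-- p ∣ K and f vanishes on multiples of p²:  Σ_{u ∣ p K} f(u) = Σ_{u ∣ K} f(u).
-- Both sides split (with K = p L) into the same two pieces over divisors of L.
Σ∣-repeated-prime : ∀ p L (f : ℕ → ℤ) → Prime p → 1 ≤ L → (∀ v → 1 ≤ v → f (p ℕ.* (p ℕ.* v)) ≡ + 0) →
                    Σ∣ (p ℕ.* (p ℕ.* L)) f ≡ Σ∣ (p ℕ.* L) f
Σ∣-repeated-prime (suc d) L f pp L≥1 van = begin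
  Σ∣ (P ℕ.* K) f                                            ≡⟨ Σ∣-split d K f pp K≥1 ⟩
  Σ∣ K (λ u → 𝟙∤ P u * f u) + Σ∣ K (λ v → f (P ℕ.* v))      ≡⟨ cong₂ _+_ prime-to-p multiples-of-p ⟩
  Σ∣ L (λ u → 𝟙∤ P u * f u) + Σ∣ L (λ v → f (P ℕ.* v))      ≡⟨ sym (Σ∣-split d L f pp L≥1) ⟩
  Σ∣ K f                                                    ∎
  where
  P = suc d
  K = P ℕ.* L
  K≥1 : 1 ≤ K
  K≥1 = 1≤* {P} (s≤s z≤n) L≥1
  -- the divisors of p L prime to p are those of L; multiples of p drop out
  prime-to-p : Σ∣ K (λ u → 𝟙∤ P u * f u) ≡ Σ∣ L (λ u → 𝟙∤ P u * f u)
  prime-to-p = trans (Σ∣-split d L _ pp L≥1) (trans (cong₂ _+_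
      (Σ∣-cong L (λ u _ _ → 𝟙-idem (does (¬? (P ∣? u))) (f u)))
      (Σ∣-zero L (λ v _ _ → trans (cong (_* f (P ℕ.* v)) (𝟙-no (¬? (P ∣? (P ℕ.* v))) (λ ¬p∣ → ¬p∣ (m∣m*n v))))
                                  (ZP.*-zeroˡ (f (P ℕ.* v))))))
    (ZP.+-identityʳ _))
  -- f(p v) for v ∣ p L: the terms with p ∣ v vanish, the rest are f(p v), v ∣ L
  multiples-of-p : Σ∣ K (λ v → f (P ℕ.* v)) ≡ Σ∣ L (λ v → f (P ℕ.* v))
  multiples-of-p = trans (Σ∣-split d L _ pp L≥1) (trans (cong₂ _+_
      (Σ∣-cong L (λ v v≥1 _ → drop-multiples v v≥1 (P ∣? v)))
      (Σ∣-zero L (λ v v≥1 _ → van v v≥1)))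
    (ZP.+-identityʳ _))
    where
    drop-multiples : ∀ v → 1 ≤ v → (D : Dec (P ∣ v)) → 𝟙 (not (does D)) * f (P ℕ.* v) ≡ f (P ℕ.* v)
    drop-multiples v v≥1 (yes (divides q refl)) = trans (ZP.*-zeroˡ (f (P ℕ.* (q ℕ.* P))))
      (sym (trans (cong (λ z → f (P ℕ.* z)) (NP.*-comm q P)) (van q (1≤-factor q P v≥1))))
    drop-multiples v v≥1 (no _) = ZP.*-identityˡ _

DivisorSums : ℕ → Set
DivisorSums M = (Σ∣ M μ ≡ δ M 1) × (Σ∣ M absμ ≡ + (2 ^ ω M))

divisor-sums-1 : DivisorSums 1
divisor-sums-1 = single , single
  where
  single : ∀ {f : ℕ → ℤ} → Σ∣ 1 f ≡ + 1 * f 1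
  single = ΣR-single 1 1 1 _ NP.≤-refl NP.≤-refl (λ u u≥1 u≤1 u≢1 → ⊥-elim (u≢1 (NP.≤-antisym u≤1 u≥1)))

δ-≥2 : ∀ x → 2 ≤ x → δ x 1 ≡ + 0
δ-≥2 x x≥2 = δ-no x 1 (λ e → NP.<⇒≢ x≥2 (sym e))

μ-p² : ∀ p → Prime p → ∀ v → 1 ≤ v → μ (p ℕ.* (p ℕ.* v)) ≡ + 0
μ-p² p pp v v≥1 = μ-square-factor p (p ℕ.* (p ℕ.* v)) pp (1≤* (prime≥1 pp) (1≤* (prime≥1 pp) v≥1))
  (subst ((p ℕ.* p) ∣_) (NP.*-assoc p p v) (m∣m*n v))

divisor-sums-repeated : ∀ p K → Prime p → 1 ≤ K → p ∣ K → DivisorSums K → DivisorSums (p ℕ.* K)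
divisor-sums-repeated p K pp K≥1 (divides L refl) (sumμ , sum|μ|) = sumμ′ , sum|μ|′
  where
  L≥1 = 1≤-factor L p K≥1
  K≥2 : 2 ≤ L ℕ.* p
  K≥2 = NP.≤-trans (prime≥2 pp) (NP.m≤n*m p L {{>-nonZero L≥1}})
  reduce : ∀ (f : ℕ → ℤ) → (∀ v → 1 ≤ v → f (p ℕ.* (p ℕ.* v)) ≡ + 0) → Σ∣ (p ℕ.* (L ℕ.* p)) f ≡ Σ∣ (L ℕ.* p) f
  reduce f van = subst (λ z → Σ∣ (p ℕ.* z) f ≡ Σ∣ z f) (NP.*-comm p L) (Σ∣-repeated-prime p L f pp L≥1 van)
  sumμ′ = begin
    Σ∣ (p ℕ.* (L ℕ.* p)) μ   ≡⟨ reduce μ (μ-p² p pp) ⟩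
    Σ∣ (L ℕ.* p) μ           ≡⟨ sumμ ⟩
    δ (L ℕ.* p) 1            ≡⟨ δ-≥2 _ K≥2 ⟩
    + 0                      ≡⟨ sym (δ-≥2 _ (NP.≤-trans K≥2 (NP.m≤n*m (L ℕ.* p) p {{>-nonZero (prime≥1 pp)}}))) ⟩
    δ (p ℕ.* (L ℕ.* p)) 1    ∎
  sum|μ|′ = begin
    Σ∣ (p ℕ.* (L ℕ.* p)) absμ  ≡⟨ reduce absμ (λ v v≥1 → cong (λ z → + ∣ z ∣) (μ-p² p pp v v≥1)) ⟩
    Σ∣ (L ℕ.* p) absμ          ≡⟨ sum|μ| ⟩
    + (2 ^ ω (L ℕ.* p))        ≡⟨ cong (λ z → + (2 ^ z)) (sym (ω-dvd p (L ℕ.* p) pp K≥1 (divides L refl))) ⟩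
    + (2 ^ ω (p ℕ.* (L ℕ.* p))) ∎

-- multiplying by a new prime p: the divisors split into u and p u, u ∣ K,
-- with μ(p u) = -μ(u), so the μ-sum cancels and the |μ|-sum doubles
divisor-sums-new : ∀ p K → Prime p → 1 ≤ K → ¬ p ∣ K → DivisorSums K → DivisorSums (p ℕ.* K)
divisor-sums-new p K pp K≥1 p∤K (sumμ , sum|μ|) = sumμ′ , sum|μ|′
  where
  μ-flip : ∀ v → 1 ≤ v → v ∣ K → μ (p ℕ.* v) ≡ - μ v
  μ-flip v v≥1 v∣K = μ-mul-prime p v pp v≥1 (λ p∣v → p∤K (∣-trans p∣v v∣K))
  sumμ′ = begin
    Σ∣ (p ℕ.* K) μ                            ≡⟨ Σ∣-new-prime p K μ pp K≥1 p∤K ⟩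
    Σ∣ K μ + Σ∣ K (λ v → μ (p ℕ.* v))         ≡⟨ cong (_+_ (Σ∣ K μ)) (trans (Σ∣-cong K μ-flip) (Σ∣-neg K μ)) ⟩
    Σ∣ K μ + - Σ∣ K μ                         ≡⟨ ZP.+-inverseʳ (Σ∣ K μ) ⟩
    + 0                                       ≡⟨ sym (δ-≥2 _ (NP.≤-trans (prime≥2 pp) (NP.m≤m*n p K {{>-nonZero K≥1}}))) ⟩
    δ (p ℕ.* K) 1                             ∎
  sum|μ|′ = begin
    Σ∣ (p ℕ.* K) absμ                         ≡⟨ Σ∣-new-prime p K absμ pp K≥1 p∤K ⟩
    Σ∣ K absμ + Σ∣ K (λ v → absμ (p ℕ.* v))   ≡⟨ cong (_+_ (Σ∣ K absμ)) (Σ∣-cong K (λ v v≥1 v∣K →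
                                                    trans (cong (λ z → + ∣ z ∣) (μ-flip v v≥1 v∣K)) (cong +_ (ZP.∣-i∣≡∣i∣ (μ v))))) ⟩
    Σ∣ K absμ + Σ∣ K absμ                     ≡⟨ cong₂ _+_ sum|μ| sum|μ| ⟩
    + (2 ^ ω K) + + (2 ^ ω K)                 ≡⟨ sym (ZP.pos-+ (2 ^ ω K) (2 ^ ω K)) ⟩
    + (2 ^ ω K ℕ.+ 2 ^ ω K)                   ≡⟨ cong (λ z → + (2 ^ ω K ℕ.+ z)) (sym (NP.+-identityʳ (2 ^ ω K))) ⟩
    + (2 ^ suc (ω K))                         ≡⟨ cong (λ z → + (2 ^ z)) (sym (ω-ndvd p K pp K≥1 p∤K)) ⟩
    + (2 ^ ω (p ℕ.* K))                       ∎

product-of-primes-pos : ∀ fs → All Prime fs → 1 ≤ product fs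
product-of-primes-pos []       []         = s≤s z≤n
product-of-primes-pos (q ∷ qs) (pq ∷ pqs) = 1≤* (prime≥1 pq) (product-of-primes-pos qs pqs)

divisor-sums-product : ∀ fs → All Prime fs → DivisorSums (product fs)
divisor-sums-product []       []         = divisor-sums-1
divisor-sums-product (q ∷ qs) (pq ∷ pqs) with q ∣? product qs
... | yes q∣K = divisor-sums-repeated q (product qs) pq (product-of-primes-pos qs pqs) q∣K (divisor-sums-product qs pqs)
... | no q∤K  = divisor-sums-new q (product qs) pq (product-of-primes-pos qs pqs) q∤K (divisor-sums-product qs pqs)

divisor-sums : ∀ M → 1 ≤ M → DivisorSums M
divisor-sums (suc M) _ = subst DivisorSums (sym (PrimeFactorisation.isFactorisation F))
  (divisor-sums-product (PrimeFactorisation.factors F) (PrimeFactorisation.factorsPrime F))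
  where
  F = factorise (suc M)

pℤ-neg : ∀ a b → a < b → pℤ (+ a - + b) ≡ + 0
pℤ-neg a b a<b = cong pℤ (trans (ZP.m-n≡m⊖n a b)
  (trans (ZP.⊖-< a<b) (cong (λ z → - (+ z)) (pred-suc (b ∸ a) (NP.m<n⇒0<n∸m a<b)))))
  where
  pred-suc : ∀ k → 0 < k → k ≡ suc (k ∸ 1)
  pred-suc (suc k) _ = refl

pℤ-nonneg : ∀ a b → b ≤ a → pℤ (+ a - + b) ≡ + p (a ∸ b)
pℤ-nonneg a b b≤a = cong pℤ (trans (ZP.m-n≡m⊖n a b) (ZP.⊖-≥ b≤a))

pℤ-jt : ∀ d j t → d < j ℕ.* t → pℤ (+ d - + j * + t) ≡ + 0
pℤ-jt d j t d<jt = trans (cong (λ z → pℤ (+ d - z)) (sym (ZP.pos-* j t))) (pℤ-neg d (j ℕ.* t) d<jt)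

-- partSum d j = Σ_{t=1}^{d} p(d - j t), the inner sum over i in the theorem
partSum : ℕ → ℕ → ℤ
partSum d j = ΣR 1 d (λ t → pℤ (+ d - + j * + t))

-- for j ≥ 1 the terms with t > d vanish, so any upper bound N ≥ d will do
partSum-ext : ∀ d j N → 1 ≤ j → d ≤ N → partSum d j ≡ ΣR 1 N (λ t → pℤ (+ d - + j * + t))
partSum-ext d j N j≥1 d≤N = ΣR-ext 1 d N _ d≤N
  (λ t d<t _ → pℤ-jt d j t (NP.<-≤-trans d<t (NP.m≤n*m t j {{>-nonZero j≥1}})))

partSum-zero : ∀ d j → d < j → partSum d j ≡ + 0
partSum-zero d j d<j = ΣR-zero 1 d (λ t t≥1 _ → pℤ-jt d j t (NP.<-≤-trans d<j (NP.m≤m*n j t {{>-nonZero t≥1}})))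

geomQ-as-δ-sum : ∀ k i → geomQ k i ≡ ΣR 1 i (λ t → δ (k ℕ.* t) i)
geomQ-as-δ-sum k i = sym (ΣR-def 1 i (λ t → δ (k ℕ.* t) i))

geomQ-divides : ∀ d i → 1 ≤ i → geomQ (suc d) i ≡ 𝟙∣ (suc d) i
geomQ-divides d i i≥1 = trans (geomQ-as-δ-sum (suc d) i) (sym (divides-as-δ-sum d i i i≥1 (NP.m≤n*m i (suc d))))

-- μ(k/d), with the convention of Defs.inner that d = 0 does not occur
μquot : ℕ → ℕ → ℤ
μquot k zero    = + 0
μquot k (suc e) = μ (k / suc e)

inner-as-divisor-sum : ∀ k j → 1 ≤ k → inner k j ≡ Σ∣ k (λ d → partSum d j * μquot k d)
inner-as-divisor-sum (suc k') j _ = begin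
  inner k j                  ≡⟨ sym (ΣR-def 0 k' (term ∘ suc)) ⟩
  ΣR 0 k' (term ∘ suc)        ≡⟨ ΣR-shift k' term ⟩
  ΣR 1 k term                 ≡⟨ ΣR-cong 1 k (λ d d≥1 _ → as-Σ∣-term d d≥1) ⟩
  Σ∣ k (λ d → partSum d j * μquot k d) ∎
  where
  k = suc k'
  term : ℕ → ℤ
  term zero    = + 0
  term (suc e) = if does (suc e ∣? k)
                 then Σℤ (range 1 (suc e)) (λ i → pℤ (+ (suc e) - (+ j * + i)) * μ (k / suc e))
                 else + 0
  as-Σ∣-term : ∀ d → 1 ≤ d → term d ≡ 𝟙∣ d k * (partSum d j * μquot k d)
  as-Σ∣-term (suc e) _ = trans (if-as-𝟙 (does (suc e ∣? k)) _) (cong (𝟙∣ (suc e) k *_)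
    (trans (sym (ΣR-def 1 (suc e) _)) (sym (ΣR-*ʳ 1 (suc e) (μ (k / suc e)) _))))

coefA : ℕ → ℤ
coefA k = ΣR 1 k (λ j → inner k j * absμ j)

coefB : ℕ → ℕ → ℤ
coefB n m = ΣR 1 n (λ j → absμ j * partSum m j)

coefA-as-divisor-sum : ∀ n k → 1 ≤ k → k ≤ n → coefA k ≡ ΣR 1 n (λ d → 𝟙∣ d k * μquot k d * coefB n d)
coefA-as-divisor-sum n k k≥1 k≤n = begin
  ΣR 1 k (λ j → inner k j * absμ j)
    ≡⟨ ΣR-ext 1 k n _ k≤n (λ j k<j _ → trans (cong (_* absμ j) (inner-vanishes j k<j)) (ZP.*-zeroˡ (absμ j))) ⟩
  ΣR 1 n (λ j → inner k j * absμ j)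
    ≡⟨ ΣR-cong 1 n (λ j _ _ → trans (cong (_* absμ j) (trans (inner-as-divisor-sum k j k≥1) (widen j))) (ΣR-*ʳ 1 n (absμ j) _)) ⟩
  ΣR 1 n (λ j → ΣR 1 n (λ d → 𝟙∣ d k * (partSum d j * μquot k d) * absμ j))
    ≡⟨ ΣR-swap 1 n 1 n _ ⟩
  ΣR 1 n (λ d → ΣR 1 n (λ j → 𝟙∣ d k * (partSum d j * μquot k d) * absμ j))
    ≡⟨ ΣR-cong 1 n (λ d _ _ → trans (ΣR-cong 1 n (λ j _ _ → regroup (𝟙∣ d k) (partSum d j) (μquot k d) (absμ j)))
                                    (sym (ΣR-*ˡ 1 n (𝟙∣ d k * μquot k d) _))) ⟩
  ΣR 1 n (λ d → 𝟙∣ d k * μquot k d * coefB n d) ∎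
  where
  regroup : ∀ a c m b → a * (c * m) * b ≡ a * m * (b * c)
  regroup = solve-∀
  widen : ∀ j → Σ∣ k (λ d → partSum d j * μquot k d) ≡ ΣR 1 n (λ d → 𝟙∣ d k * (partSum d j * μquot k d))
  widen j = ΣR-ext 1 k n _ k≤n (λ d k<d _ → trans (cong (_* (partSum d j * μquot k d))
                                                        (𝟙-no (d ∣? k) (λ d∣k → NP.<⇒≱ k<d (divisor-≤ k≥1 d∣k))))
                                                  (ZP.*-zeroˡ (partSum d j * μquot k d)))
  inner-vanishes : ∀ j → k < j → inner k j ≡ + 0
  inner-vanishes j k<j = trans (inner-as-divisor-sum k j k≥1) (Σ∣-zero k (λ d _ d∣k →
    trans (cong (_* μquot k d) (partSum-zero d j (NP.≤-<-trans (divisor-≤ k≥1 d∣k) k<j))) (ZP.*-zeroˡ (μquot k d))))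

-- Σ_{1 ≤ v ≤ n, D v ∣ m} μ(v) = [D = m]  for 1 ≤ m ≤ n: only v ∣ m/D
-- contribute, and their μ-sum is [m/D = 1]
μ-sum-over-cofactors : ∀ n D m → 1 ≤ D → 1 ≤ m → m ≤ n → ΣR 1 n (λ v → 𝟙∣ (D ℕ.* v) m * μ v) ≡ δ D m
μ-sum-over-cofactors n D m D≥1 m≥1 m≤n with D ∣? m
... | yes (divides M refl) = begin
  ΣR 1 n (λ v → 𝟙∣ (D ℕ.* v) (M ℕ.* D) * μ v)
    ≡⟨ ΣR-cong 1 n (λ v _ _ → cong (λ b → 𝟙 b * μ v) (does-iff ((D ℕ.* v) ∣? (M ℕ.* D)) (v ∣? M)
         (λ h → *-cancelˡ-∣ D {{>-nonZero D≥1}} (subst ((D ℕ.* v) ∣_) (NP.*-comm M D) h))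
         (λ h → subst ((D ℕ.* v) ∣_) (NP.*-comm D M) (*-monoʳ-∣ D h)))) ⟩
  ΣR 1 n (λ v → 𝟙∣ v M * μ v)
    ≡⟨ sym (ΣR-ext 1 M n _ (NP.≤-trans (NP.m≤m*n M D {{>-nonZero D≥1}}) m≤n)
         (λ v M<v _ → trans (cong (_* μ v) (𝟙-no (v ∣? M) (λ v∣ → NP.<⇒≱ M<v (divisor-≤ M≥1 v∣)))) (ZP.*-zeroˡ (μ v)))) ⟩
  Σ∣ M μ
    ≡⟨ proj₁ (divisor-sums M M≥1) ⟩
  δ M 1
    ≡⟨ δ-cofactor (M ≟ 1) ⟩
  δ D (M ℕ.* D) ∎
  where
  M≥1 = 1≤-factor M D m≥1
  δ-cofactor : Dec (M ≡ 1) → δ M 1 ≡ δ D (M ℕ.* D)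
  δ-cofactor (yes refl) = trans (δ-refl 1) (sym (trans (cong (δ D) (NP.*-identityˡ D)) (δ-refl D)))
  δ-cofactor (no M≢1)   = trans (δ-no M 1 M≢1) (sym (δ-no D (M ℕ.* D)
    (λ e → M≢1 (NP.*-cancelʳ-≡ M 1 D {{>-nonZero D≥1}} (trans (sym e) (sym (NP.*-identityˡ D)))))))
... | no D∤m = trans
  (ΣR-zero 1 n (λ v _ _ → trans (cong (_* μ v) (𝟙-no ((D ℕ.* v) ∣? m) (λ h → D∤m (∣-trans (m∣m*n v) h)))) (ZP.*-zeroˡ (μ v))))
  (sym (δ-no D m (λ e → D∤m (subst (D ∣_) e n∣n))))

möbius-geomQ : ∀ n d m → 1 ≤ d → d ≤ n → 1 ≤ m → m ≤ n →
               ΣR 1 n (λ k → geomQ k m * (𝟙∣ d k * μquot k d)) ≡ δ d m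
möbius-geomQ n (suc d') m _ d≤n m≥1 m≤n = begin
  ΣR 1 n (λ k → geomQ k m * (𝟙∣ D k * μquot k D))
    ≡⟨ ΣR-cong 1 n (λ k k≥1 _ → as-divisor-term k k≥1) ⟩
  ΣR 1 n (λ k → 𝟙∣ D k * g k)
    ≡⟨ ΣR-ext 1 n (D ℕ.* n) _ (NP.m≤n*m n D) (λ k n<k _ → trans (cong (λ z → 𝟙∣ D k * (z * μ (k / D)))
         (𝟙-no (k ∣? m) (λ k∣m → NP.<⇒≱ (NP.≤-<-trans m≤n n<k) (divisor-≤ m≥1 k∣m))))
         (trans (cong (𝟙∣ D k *_) (ZP.*-zeroˡ (μ (k / D)))) (ZP.*-zeroʳ (𝟙∣ D k)))) ⟩
  ΣR 1 (D ℕ.* n) (λ k → 𝟙∣ D k * g k)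
    ≡⟨ ΣR-multiples d' n g ⟩
  ΣR 1 n (λ v → 𝟙∣ (D ℕ.* v) m * μ (D ℕ.* v / D))
    ≡⟨ ΣR-cong 1 n (λ v _ _ → cong (λ z → 𝟙∣ (D ℕ.* v) m * μ z) (trans (cong (_/ D) (NP.*-comm D v)) (m*n/n≡m v D))) ⟩
  ΣR 1 n (λ v → 𝟙∣ (D ℕ.* v) m * μ v)
    ≡⟨ μ-sum-over-cofactors n D m (s≤s z≤n) m≥1 m≤n ⟩
  δ D m ∎
  where
  D = suc d'
  g : ℕ → ℤ
  g k = 𝟙∣ k m * μ (k / D)
  swap-front : ∀ a b c → a * (b * c) ≡ b * (a * c)
  swap-front = solve-∀
  as-divisor-term : ∀ k → 1 ≤ k → geomQ k m * (𝟙∣ D k * μquot k D) ≡ 𝟙∣ D k * g k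
  as-divisor-term (suc k') _ = trans (cong (_* (𝟙∣ D (suc k') * μ (suc k' / D))) (geomQ-divides k' m m≥1))
                                     (swap-front (𝟙∣ (suc k') m) (𝟙∣ D (suc k')) (μ (suc k' / D)))

geomQ-inversion : ∀ n m → m ≤ n → ΣR 1 n (λ k → geomQ k m * coefA k) ≡ coefB n m
geomQ-inversion n zero _ = trans (ΣR-zero 1 n (λ k _ _ → ZP.*-zeroˡ (coefA k)))
  (sym (ΣR-zero 1 n (λ j _ _ → trans (cong (absμ j *_) (ΣR-empty 1 0 _ (s≤s z≤n))) (ZP.*-zeroʳ (absμ j)))))
geomQ-inversion n (suc m') m≤n = begin
  ΣR 1 n (λ k → geomQ k m * coefA k)
    ≡⟨ ΣR-cong 1 n (λ k k≥1 k≤n → trans (cong (geomQ k m *_) (coefA-as-divisor-sum n k k≥1 k≤n))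
         (trans (ΣR-*ˡ 1 n (geomQ k m) _) (ΣR-cong 1 n (λ d _ _ → regroup (geomQ k m) (𝟙∣ d k) (μquot k d) (coefB n d))))) ⟩
  ΣR 1 n (λ k → ΣR 1 n (λ d → coefB n d * (geomQ k m * (𝟙∣ d k * μquot k d))))
    ≡⟨ ΣR-swap 1 n 1 n _ ⟩
  ΣR 1 n (λ d → ΣR 1 n (λ k → coefB n d * (geomQ k m * (𝟙∣ d k * μquot k d))))
    ≡⟨ ΣR-cong 1 n (λ d d≥1 d≤n → trans (sym (ΣR-*ˡ 1 n (coefB n d) _))
         (cong (coefB n d *_) (möbius-geomQ n d m d≥1 d≤n (s≤s z≤n) m≤n))) ⟩
  ΣR 1 n (λ d → coefB n d * δ d m)
    ≡⟨ ΣR-single 1 n m _ (s≤s z≤n) m≤n (λ d _ _ d≢ → trans (cong (coefB n d *_) (δ-no d m d≢)) (ZP.*-zeroʳ (coefB n d))) ⟩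
  coefB n m * δ m m
    ≡⟨ trans (cong (coefB n m *_) (δ-refl m)) (ZP.*-identityʳ (coefB n m)) ⟩
  coefB n m ∎
  where
  m = suc m'
  regroup : ∀ g a u b → g * (a * u * b) ≡ b * (g * (a * u))
  regroup = solve-∀

one-as-δ : ∀ x n → x ≤ n → one (n ∸ x) ≡ δ x n
one-as-δ x n x≤n with x ≟ n
... | yes refl = trans (cong one (NP.n∸n≡0 x)) (sym (δ-refl x))
... | no x≢n   = trans (positive (n ∸ x) refl) (sym (δ-no x n x≢n))
  where
  positive : ∀ k → n ∸ x ≡ k → one k ≡ + 0
  positive zero    e = ⊥-elim (x≢n (NP.≤-antisym x≤n (NP.m∸n≡0⇒m≤n e)))
  positive (suc k) e = refl

euler-shift : ∀ n x → ΣR 0 n (λ i → qq∞ i * pℤ (+ (n ∸ i) - + x)) ≡ δ x n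
euler-shift n x with x NP.≤? n
... | yes x≤n = begin
    ΣR 0 n (λ i → qq∞ i * pℤ (+ (n ∸ i) - + x))
      ≡⟨ sym (ΣR-ext 0 m n _ (NP.m∸n≤m n x) (λ i m<i i≤n →
           trans (cong (qq∞ i *_) (pℤ-neg (n ∸ i) x (too-far i m<i i≤n))) (ZP.*-zeroʳ (qq∞ i)))) ⟩
    ΣR 0 m (λ i → qq∞ i * pℤ (+ (n ∸ i) - + x))
      ≡⟨ ΣR-cong 0 m (λ i _ i≤m → cong (qq∞ i *_)
           (trans (pℤ-nonneg (n ∸ i) x (in-range i i≤m)) (cong (λ z → + p z) (reassoc i)))) ⟩
    ΣR 0 m (λ i → qq∞ i * partitionSeries (m ∸ i))
      ≡⟨ sym (⊛-as-ΣR qq∞ partitionSeries m) ⟩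
    (qq∞ ⊛ partitionSeries) m
      ≡⟨ euler-inverse m ⟩
    one m
      ≡⟨ one-as-δ x n x≤n ⟩
    δ x n ∎
  where
  m = n ∸ x
  too-far : ∀ i → m < i → i ≤ n → n ∸ i < x
  too-far i m<i i≤n = NP.≰⇒> (λ x≤ni → NP.<⇒≱ m<i
    (NP.m+n≤o⇒m≤o∸n i (subst (_≤ n) (NP.+-comm x i) (NP.m≤o∸n⇒m+n≤o x i≤n x≤ni))))
  in-range : ∀ i → i ≤ m → x ≤ n ∸ i
  in-range i i≤m = NP.m+n≤o⇒m≤o∸n x (subst (_≤ n) (NP.+-comm i x) (NP.m≤o∸n⇒m+n≤o i x≤n i≤m))
  reassoc : ∀ i → n ∸ i ∸ x ≡ m ∸ i
  reassoc i = trans (NP.∸-+-assoc n i x) (trans (cong (n ∸_) (NP.+-comm i x)) (sym (NP.∸-+-assoc n x i)))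
... | no x≰n = trans
  (ΣR-zero 0 n (λ i _ _ → trans (cong (qq∞ i *_) (pℤ-neg (n ∸ i) x (NP.≤-<-trans (NP.m∸n≤m n i) (NP.≰⇒> x≰n))))
                                (ZP.*-zeroʳ (qq∞ i))))
  (sym (δ-no x n (x≰n ∘ NP.≤-reflexive)))

euler-collapse : ∀ n → ΣR 0 n (λ i → qq∞ i * coefB n (n ∸ i)) ≡ ΣR 1 n (λ j → absμ j * geomQ j n)
euler-collapse n = begin
  ΣR 0 n (λ i → qq∞ i * coefB n (n ∸ i))
    ≡⟨ ΣR-cong 0 n (λ i _ _ → expand i) ⟩
  ΣR 0 n (λ i → ΣR 1 n (λ j → ΣR 1 n (λ t → term i j t)))
    ≡⟨ ΣR-swap 0 n 1 n _ ⟩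
  ΣR 1 n (λ j → ΣR 0 n (λ i → ΣR 1 n (λ t → term i j t)))
    ≡⟨ ΣR-cong 1 n (λ j _ _ → ΣR-swap 0 n 1 n _) ⟩
  ΣR 1 n (λ j → ΣR 1 n (λ t → ΣR 0 n (λ i → term i j t)))
    ≡⟨ ΣR-cong 1 n (λ j _ _ → ΣR-cong 1 n (λ t _ _ → sum-over-i j t)) ⟩
  ΣR 1 n (λ j → ΣR 1 n (λ t → absμ j * δ (j ℕ.* t) n))
    ≡⟨ ΣR-cong 1 n (λ j _ _ → trans (sym (ΣR-*ˡ 1 n (absμ j) _)) (cong (absμ j *_) (sym (geomQ-as-δ-sum j n)))) ⟩
  ΣR 1 n (λ j → absμ j * geomQ j n) ∎
  where
  term : ℕ → ℕ → ℕ → ℤ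
  term i j t = qq∞ i * (absμ j * pℤ (+ (n ∸ i) - + j * + t))
  expand : ∀ i → qq∞ i * coefB n (n ∸ i) ≡ ΣR 1 n (λ j → ΣR 1 n (λ t → term i j t))
  expand i = trans (ΣR-*ˡ 1 n (qq∞ i) _) (ΣR-cong 1 n (λ j j≥1 _ →
    trans (cong (λ z → qq∞ i * (absμ j * z)) (partSum-ext (n ∸ i) j n j≥1 (NP.m∸n≤m n i)))
    (trans (cong (qq∞ i *_) (ΣR-*ˡ 1 n (absμ j) _)) (ΣR-*ˡ 1 n (qq∞ i) _))))
  swap-front : ∀ a b c → a * (b * c) ≡ b * (a * c)
  swap-front = solve-∀
  sum-over-i : ∀ j t → ΣR 0 n (λ i → term i j t) ≡ absμ j * δ (j ℕ.* t) n
  sum-over-i j t = begin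
    ΣR 0 n (λ i → term i j t)
      ≡⟨ ΣR-cong 0 n (λ i _ _ → trans (swap-front (qq∞ i) (absμ j) _)
           (cong (λ z → absμ j * (qq∞ i * pℤ (+ (n ∸ i) - z))) (sym (ZP.pos-* j t)))) ⟩
    ΣR 0 n (λ i → absμ j * (qq∞ i * pℤ (+ (n ∸ i) - + (j ℕ.* t))))
      ≡⟨ sym (ΣR-*ˡ 0 n (absμ j) _) ⟩
    absμ j * ΣR 0 n (λ i → qq∞ i * pℤ (+ (n ∸ i) - + (j ℕ.* t)))
      ≡⟨ cong (absμ j *_) (euler-shift n (j ℕ.* t)) ⟩
    absμ j * δ (j ℕ.* t) n ∎

squarefree-divisor-count : ∀ n → 1 ≤ n → ΣR 1 n (λ j → absμ j * geomQ j n) ≡ + (2 ^ ω n)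
squarefree-divisor-count n n≥1 = trans (ΣR-cong 1 n as-Σ∣-term) (proj₂ (divisor-sums n n≥1))
  where
  as-Σ∣-term : ∀ j → 1 ≤ j → j ≤ n → absμ j * geomQ j n ≡ 𝟙∣ j n * absμ j
  as-Σ∣-term (suc d) _ _ = trans (cong (absμ (suc d) *_) (geomQ-divides d n n≥1)) (ZP.*-comm (absμ (suc d)) (𝟙∣ (suc d) n))

S-as-Σ-s-coefA : ∀ n → S n ≡ ΣR 1 n (λ k → s n k * coefA k)
S-as-Σ-s-coefA n = trans (sym (ΣR-def 1 n _)) (ΣR-cong 1 n (λ k _ _ →
  trans (sym (ΣR-def 1 k _)) (trans (ΣR-cong 1 k (λ j _ _ → pull-out (inner k j) (s n k) (absμ j)))
                                    (sym (ΣR-*ˡ 1 k (s n k) _)))))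
  where
  pull-out : ∀ a b c → a * b * c ≡ b * (a * c)
  pull-out = solve-∀

-- Step 1b: expanding s_{n,k} as a Cauchy product and exchanging the sums,
-- the sum over k is exactly the one evaluated by geomQ-inversion
Σ-s-coefA : ∀ n → ΣR 1 n (λ k → s n k * coefA k) ≡ ΣR 0 n (λ i → qq∞ i * coefB n (n ∸ i))
Σ-s-coefA n = begin
  ΣR 1 n (λ k → s n k * coefA k)
    ≡⟨ ΣR-cong 1 n (λ k _ _ → trans (cong (_* coefA k) (⊛-as-ΣR qq∞ (geomQ k) n))
         (trans (ΣR-*ʳ 0 n (coefA k) _) (ΣR-cong 0 n (λ i _ _ → ZP.*-assoc (qq∞ i) (geomQ k (n ∸ i)) (coefA k))))) ⟩
  ΣR 1 n (λ k → ΣR 0 n (λ i → qq∞ i * (geomQ k (n ∸ i) * coefA k)))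
    ≡⟨ ΣR-swap 1 n 0 n _ ⟩
  ΣR 0 n (λ i → ΣR 1 n (λ k → qq∞ i * (geomQ k (n ∸ i) * coefA k)))
    ≡⟨ ΣR-cong 0 n (λ i _ _ → trans (sym (ΣR-*ˡ 1 n (qq∞ i) _)) (cong (qq∞ i *_) (geomQ-inversion n (n ∸ i) (NP.m∸n≤m n i)))) ⟩
  ΣR 0 n (λ i → qq∞ i * coefB n (n ∸ i)) ∎

mainTheorem8 : (n : ℕ) → n ≥ 1 → S n ≡ + (2 ^ ω n)
mainTheorem8 n n≥1 = begin
  S n                                      ≡⟨ S-as-Σ-s-coefA n ⟩
  ΣR 1 n (λ k → s n k * coefA k)           ≡⟨ Σ-s-coefA n ⟩
  ΣR 0 n (λ i → qq∞ i * coefB n (n ∸ i))   ≡⟨ euler-collapse n ⟩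
  ΣR 1 n (λ j → absμ j * geomQ j n)        ≡⟨ squarefree-divisor-count n n≥1 ⟩
  + (2 ^ ω n)                              ∎
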